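{- Let $(p_1,\dots,p_n)$ be a growth sequence, let $(\lambda,L)$ be the Dyck path with natural labeling it determines, let $\sigma=L_0\circ L^{ -1}$, and let $w$ be the min-word of $\operatorname{match}(p_1,\dots,p_n)$. Then $\operatorname{DES}(\sigma)=\operatorname{DES}(w)$. In particular, $\operatorname{dis}(\operatorname{DTR}(p_1,\dots,p_n))=\operatorname{des}(w)$.
   Context: For a word $w=w_1\cdots w_n$, $\operatorname{DES}(w)=\{i<n:w_i>w_{i+1}\}$ and $\operatorname{des}(w)=|\operatorname{DES}(w)|$. Dyck paths. A Dyck path of order $n$ is a lattice path from $(-n,0)$ to $(n,0)$ with steps $(+1,+1)$ (up) and $(+1,-1)$ (down) never going below the $x$-axis; $\rho(x)$ is its height at $x$; steps are numbered $1,\dots,2n$ left to right. Column $s$ is the line $x=s$. Each up step is matched with a down step as in balanced parentheses; such a pair is a chord. Chord poset $P_\lambda$: $c<c'$ iff both steps of $c'$ lie strictly between those of $c$. A natural labeling is a bijection $L:P_\lambda\to[n]$ with $L(c)<L(c')$ whenever $c<c'$; $L_0$ numbers chords by the left-to-right order of their up steps. Growth sequences. A growth sequence of length $n$ is $(p_1,\dots,p_n)$ with integers $0\le p_i\le 2(i-1)$. It determines $(\lambda,L)$: start with the empty word, and for $i=1,\dots,n$ insert UD immediately after the first $p_i$ letters of the current word, labeling the new chord $i$. Matchings. $\operatorname{match}()$ is the empty matching; $\operatorname{match}(p_1,\dots,p_n)$ is obtained from $\operatorname{match}(p_1,\dots,p_{n-1})$ (a perfect matching of $[2n-2]$) by increasing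 by $1$ every number larger than $p_n$ and adjoining the pair $\{p_n+1,2n\}$. The min-word of a perfect matching of $[2n]$ lists the smaller element of each pair, ordered by increasing larger element. Dyck tilings. A box is a square with vertices $(x,y),(x+1,y+1),(x,y+2),(x-1,y+1)$ (lower corner $(x,y)$, column $x$). For Dyck paths $\lambda,\mu$ of order $n$ with $\mu$ weakly above $\lambda$, a Dyck tiling of $\lambda/\mu$ is a partition of the boxes between them into Dyck tiles: nonempty sets of boxes, one in each of a set of consecutive columns, whose lower corners read left to right form a lattice path with steps $(+1,\pm1)$ with first and last points of equal height and none lower. $\operatorname{dis}(T)$ is the number of $k$ with step $k$ of $\lambda$ down and step $k$ of $\mu$ up. Spread. The spread at column $s$ of a path $\rho$ is $\{(x-1,y):(x,y)\in\rho,x\le s\}\cup\{(x,y+1):(x,y)\in\rho,x=s\}\cup\{(x+1,y):(x,y)\in\rho,x\ge s\}$; spreading a tiling spreads its lower path, upper path and all tile lower-corner paths. For a tiling $T$ with upper path $\mu$, column $s$ is eligible if $\mu$ has an up step ending in column $s$ and the point of $\mu$ at column $s$ is not the top corner of a one-box tile; the special column is the rightmost eligible column. DTR. For $T$ of order $n$ and $-n\le s\le n$, let $T''$ be the spread of $T$ at $s$, with upper path $\mu''$ and special column $Q$; $\mathrm{rgrow}(T,s)$ is $T''$ together with, if $Q>s$, the one-box tiles with lower corners $(c,\mu''(c))$ for $s<c<Q$. $\operatorname{DTR}()$ is the empty tiling of order $0$ and $\operatorname{DTR}(p_1,\dots,p_n)=\mathrm{rgrow}(\operatorname{DTR}(p_1,\dots,p_{n-1}),p_n-(n-1))$.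 -}

module Defs where

open import Data.Bool using (Bool; true; false; if_then_else_; _∧_; not)
open import Data.Nat as ℕ using (ℕ; zero; suc; _≤_; _<ᵇ_; _≡ᵇ_; _⊔_; _⊓_)
open import Data.Integer as ℤ using (ℤ; +_; _≤ᵇ_)
open import Data.Product using (_×_; _,_; proj₁; proj₂)
open import Data.List using (List; []; _∷_; _++_; map; concatMap; applyUpTo;
  filterᵇ; length; take; drop; last; zip)
open import Data.Maybe using (Maybe; just; nothing)
open import Data.Vec using (Vec; lookup; toList)
open import Data.Fin using (Fin; toℕ)

-- positions (1-based) i < length w with w_i > w_{i+1}, listed increasingly;
-- equality of these lists is equality of descent sets.
DESfrom : ℕ → List ℕ → List ℕ
DESfrom i (x ∷ y ∷ r) = (if y <ᵇ x then i ∷ [] else []) ++ DESfrom (suc i) (y ∷ r)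
DESfrom i _ = []

DES : List ℕ → List ℕ
DES = DESfrom 1

des : List ℕ → ℕ
des w = length (DES w)

-- Growth sequences  (p_1,...,p_n), 0 ≤ p_i ≤ 2(i-1)   (index i = toℕ k + 1)

IsGrowth : {n : ℕ} → Vec ℕ n → Set
IsGrowth {n} p = (k : Fin n) → lookup p k ≤ 2 ℕ.* toℕ k

-- Labeled Dyck words: each letter carries the label of its chord

data Letter : Set where
  up   : ℕ → Letter
  down : ℕ → Letter

insertUD : ℕ → ℕ → List Letter → List Letter
insertUD p i w = take p w ++ (up i ∷ down i ∷ drop p w)

-- i = number of chords inserted so far
labeledGo : ℕ → List Letter → List ℕ → List Letter
labeledGo i w []       = w
labeledGo i w (p ∷ ps) = labeledGo (suc i) (insertUD p (suc i) w) ps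

-- the Dyck path λ together with natural labeling L
labeledPath : {n : ℕ} → Vec ℕ n → List Letter
labeledPath p = labeledGo 0 [] (toList p)

upsBefore : ℕ → List Letter → ℕ
upsBefore j []            = 0
upsBefore j (up k ∷ w)    = if k ≡ᵇ j then 0 else suc (upsBefore j w)
upsBefore j (down _ ∷ w)  = upsBefore j w

-- σ = L₀ ∘ L⁻¹ written as the word σ(1) ⋯ σ(n);
-- L₀(c) = 1 + number of up steps left of the up step of c
sigma : {n : ℕ} → Vec ℕ n → List ℕ
sigma {n} p = map (λ j → suc (upsBefore j (labeledPath p))) (applyUpTo suc n)

Matching : Set
Matching = List (ℕ × ℕ)

shiftAbove : ℕ → ℕ → ℕ
shiftAbove p x = if p <ᵇ x then suc x else x

-- i = n-1 (the current matching is a matching of [2i])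
matchGo : ℕ → Matching → List ℕ → Matching
matchGo i m []       = m
matchGo i m (p ∷ ps) =
  matchGo (suc i) ((suc p , 2 ℕ.* suc i) ∷ map (λ ab → shiftAbove p (proj₁ ab) , shiftAbove p (proj₂ ab)) m) ps

match : {n : ℕ} → Vec ℕ n → Matching
match p = matchGo 0 [] (toList p)

minWord : Matching → List ℕ
minWord m = concatMap (λ k → map (λ ab → proj₁ ab ⊓ proj₂ ab)
                                 (filterᵇ (λ ab → (proj₁ ab ⊔ proj₂ ab) ≡ᵇ k) m))
                      (applyUpTo suc (2 ℕ.* length m))

Point : Set
Point = ℤ × ℤ

-- a path is the list of its lattice points, left to right
Path : Set
Path = List Point

_<ᶻ_ : ℤ → ℤ → Bool
a <ᶻ b = (a ℤ.+ ℤ.1ℤ) ≤ᵇ b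

_==ᶻ_ : ℤ → ℤ → Bool
a ==ᶻ b = (a ≤ᵇ b) ∧ (b ≤ᵇ a)

-- A Dyck tiling: lower path, upper path, tiles (each tile given by the
-- path of lower corners of its boxes)
record Tiling : Set where
  constructor tiling
  field
    lower : Path
    upper : Path
    tiles : List Path
open Tiling public

spreadPt : ℤ → Point → List Point
spreadPt s (x , y) =
  if x <ᶻ s then (x ℤ.- ℤ.1ℤ , y) ∷ []
  else if x ==ᶻ s then (x ℤ.- ℤ.1ℤ , y) ∷ (x , y ℤ.+ ℤ.1ℤ) ∷ (x ℤ.+ ℤ.1ℤ , y) ∷ []
  else (x ℤ.+ ℤ.1ℤ , y) ∷ []

spread : ℤ → Path → Path
spread s = concatMap (spreadPt s)

spreadTiling : ℤ → Tiling → Tiling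
spreadTiling s T = tiling (spread s (lower T)) (spread s (upper T)) (map (spread s) (tiles T))

upStepEnds : Path → List Point
upStepEnds ((x₁ , y₁) ∷ (x₂ , y₂) ∷ r) =
  (if (y₁ ℤ.+ ℤ.1ℤ) ==ᶻ y₂ then (x₂ , y₂) ∷ [] else []) ++ upStepEnds ((x₂ , y₂) ∷ r)
upStepEnds _ = []

isOneBoxTopAt : Point → Path → Bool
isOneBoxTopAt (c , y) ((a , b) ∷ []) = (a ==ᶻ c) ∧ ((b ℤ.+ + 2) ==ᶻ y)
isOneBoxTopAt _ _ = false

anyᵇ : {A : Set} → (A → Bool) → List A → Bool
anyᵇ f []       = false
anyᵇ f (x ∷ xs) = if f x then true else anyᵇ f xs

eligibleColumns : Tiling → List ℤ
eligibleColumns T =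
  map proj₁ (filterᵇ (λ pt → not (anyᵇ (isOneBoxTopAt pt) (tiles T))) (upStepEnds (upper T)))

specialColumn : Tiling → Maybe ℤ
specialColumn T = last (eligibleColumns T)

strictlyBetween : ℤ → Maybe ℤ → ℤ → Bool
strictlyBetween s (just Q) c = (s <ᶻ c) ∧ (c <ᶻ Q)
strictlyBetween s nothing  c = false

-- rgrow: spread, then add the one-box tiles with lower corners (c , μ''(c)),
-- s < c < Q; the upper path becomes the upper boundary of the enlarged
-- tiling, i.e. μ'' raised by 2 at those columns.
rgrow : Tiling → ℤ → Tiling
rgrow T s = tiling (lower T'') newUpper (tiles T'' ++ newTiles)
  where
  T'' = spreadTiling s T
  Q = specialColumn T''
  inRange : Point → Bool
  inRange pt = strictlyBetween s Q (proj₁ pt)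
  newTiles = map (λ pt → pt ∷ []) (filterᵇ inRange (upper T''))
  newUpper = map (λ pt → if inRange pt then (proj₁ pt , proj₂ pt ℤ.+ + 2) else pt) (upper T'')

emptyTiling : Tiling
emptyTiling = tiling ((+ 0 , + 0) ∷ []) ((+ 0 , + 0) ∷ []) []

-- i = n-1
DTRgo : ℕ → Tiling → List ℕ → Tiling
DTRgo i T []       = T
DTRgo i T (p ∷ ps) = DTRgo (suc i) (rgrow T (+ p ℤ.- + i)) ps

DTR : {n : ℕ} → Vec ℕ n → Tiling
DTR p = DTRgo 0 emptyTiling (toList p)

stepsUp : Path → List Bool
stepsUp ((_ , y₁) ∷ (x₂ , y₂) ∷ r) = (y₁ <ᶻ y₂) ∷ stepsUp ((x₂ , y₂) ∷ r)
stepsUp _ = []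

countᵇ : List Bool → ℕ
countᵇ []           = 0
countᵇ (true ∷ bs)  = suc (countᵇ bs)
countᵇ (false ∷ bs) = countᵇ bs

dis : Tiling → ℕ
dis T = countᵇ (map (λ ab → not (proj₁ ab) ∧ proj₂ ab) (zip (stepsUp (lower T)) (stepsUp (upper T))))

module Submission where

-- All three statistics obey one recursion in the growth sequence: appending p_{i+1} creates a
-- new descent (resp. discordant step) at position i exactly when p_{i+1} ≤ p_i.
-- Min-word: inserting the pair {p+1, 2n} shifts the older minima by a strictly monotone map and
-- appends p+1, which drops below the shifted previous minimum p_i + 1 iff p ≤ p_i.
-- σ: the new up step is preceded by q = #ups among the first p letters; this shifts the older
-- positions monotonically, and q is smaller than the shifted position of chord i iff p ≤ p_i.
-- Tiling: the special column of DTR(p_1 … p_i) is always the top of the newest peak.  Spreading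
-- at p puts the new peak either right of it (nothing is raised, dis is unchanged) or, iff
-- p ≤ p_i, left of it; then the columns between are raised by one-box tiles and exactly the
-- down step of the new peak becomes discordant.

open import Defs
open import Data.Bool using (Bool; true; false; if_then_else_; _∧_; _∨_; not; T)
open import Data.Bool.Properties using (∧-zeroʳ)
open import Data.Nat as ℕ
  using (ℕ; zero; suc; _+_; _*_; _≤_; _<_; _<ᵇ_; _≡ᵇ_; _⊔_; _⊓_; z≤n; s≤s; z<s; s<s)
open import Data.Nat.Properties
open import Data.List as List
  using (List; []; _∷_; _++_; _∷ʳ_; map; concatMap; applyUpTo; filterᵇ; length; zip;
         take; drop; reverse)
open import Data.List.Properties
  using (++-assoc; ++-identityʳ; length-++; length-map; length-reverse;
         length-applyUpTo; map-++; map-∘; map-applyUpTo; applyUpTo-∷ʳ;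
         unfold-reverse; reverse-++; length-take; last-map; reverse-map; filter-++; filter-none;
         take++drop≡id)
open import Data.List.Relation.Unary.All as All using (All; []; _∷_)
import Data.List.Relation.Unary.All.Properties as All
open import Data.List.Relation.Unary.AllPairs as AllPairs using (AllPairs; []; _∷_)
import Data.List.Relation.Unary.AllPairs.Properties as AllPairs
open import Data.Product using (_×_; _,_; proj₁; proj₂; ∃₂)
open import Data.Unit using (⊤; tt)
open import Data.Sum using (_⊎_; inj₁; inj₂)
open import Data.Empty using (⊥; ⊥-elim)
open import Data.Integer as ℤ using (ℤ; 0ℤ; 1ℤ; +<+; +≤+)
import Data.Integer.Properties as ℤ
open import Data.Integer.Tactic.RingSolver using (solve-∀)
open import Data.Maybe as Maybe using (Maybe; just)
open import Data.Vec using (Vec; []; _∷_; lookup; toList)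
open import Data.Vec.Properties using (length-toList)
open import Data.Fin as Fin using (Fin; toℕ)
open import Function using (_on_)
open import Relation.Binary using (_Preserves_⟶_; tri<; tri≈; tri>)
open import Relation.Binary.PropositionalEquality
open import Relation.Nullary using (¬_)
open import Relation.Nullary.Reflects using (Reflects; det; ofʸ; ofⁿ; fromEquivalence; _×-reflects_)

yes⇒true : ∀ {A : Set} {b} → Reflects A b → A → b ≡ true
yes⇒true r a = det r (ofʸ a)

no⇒false : ∀ {A : Set} {b} → Reflects A b → ¬ A → b ≡ false
no⇒false r ¬a = det r (ofⁿ ¬a)

true⇒yes : ∀ {A : Set} {b} → Reflects A b → b ≡ true → A
true⇒yes (ofʸ a) _ = a

false⇒no : ∀ {A : Set} {b} → Reflects A b → b ≡ false → ¬ A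
false⇒no (ofⁿ ¬a) _ = ¬a

reflects-⇔ : ∀ {A B : Set} {b} → (A → B) → (B → A) → Reflects A b → Reflects B b
reflects-⇔ to from (ofʸ a)  = ofʸ (to a)
reflects-⇔ to from (ofⁿ ¬a) = ofⁿ (λ b → ¬a (from b))

<ᵇ-true : ∀ {m n} → m < n → (m <ᵇ n) ≡ true
<ᵇ-true = yes⇒true (<ᵇ-reflects-< _ _)

<ᵇ-false : ∀ {m n} → n ≤ m → (m <ᵇ n) ≡ false
<ᵇ-false n≤m = no⇒false (<ᵇ-reflects-< _ _) (≤⇒≯ n≤m)

<ᵇ≡true⇒< : ∀ {m n} → (m <ᵇ n) ≡ true → m < n
<ᵇ≡true⇒< = true⇒yes (<ᵇ-reflects-< _ _)

<ᵇ≡false⇒≥ : ∀ {m n} → (m <ᵇ n) ≡ false → n ≤ m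
<ᵇ≡false⇒≥ m<ᵇn = ≮⇒≥ (false⇒no (<ᵇ-reflects-< _ _) m<ᵇn)

≡ᵇ-reflects : ∀ m n → Reflects (m ≡ n) (m ≡ᵇ n)
≡ᵇ-reflects m n = fromEquivalence (≡ᵇ⇒≡ m n) (≡⇒≡ᵇ m n)

≡ᵇ-false : ∀ {m n} → m ≢ n → (m ≡ᵇ n) ≡ false
≡ᵇ-false = no⇒false (≡ᵇ-reflects _ _)

≡ᵇ-refl : ∀ n → (n ≡ᵇ n) ≡ true
≡ᵇ-refl n = yes⇒true (≡ᵇ-reflects n n) refl

<ᵇ-preserved : ∀ {f} → f Preserves _<_ ⟶ _<_ → ∀ x y → (f y <ᵇ f x) ≡ (y <ᵇ x)
<ᵇ-preserved {f} f-mono x y with <-cmp y x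
... | tri< y<x _ _ = trans (<ᵇ-true (f-mono y<x)) (sym (<ᵇ-true y<x))
... | tri≈ _ refl _ = trans (<ᵇ-false {f x} ≤-refl) (sym (<ᵇ-false {x} ≤-refl))
... | tri> _ _ x<y = trans (<ᵇ-false (<⇒≤ (f-mono x<y))) (sym (<ᵇ-false (<⇒≤ x<y)))

-- Descent sets

singletonIf : Bool → ℕ → List ℕ
singletonIf b i = if b then i ∷ [] else []

DESfrom-map : ∀ {f} → f Preserves _<_ ⟶ _<_ → ∀ i xs → DESfrom i (map f xs) ≡ DESfrom i xs
DESfrom-map f-mono i []           = refl
DESfrom-map f-mono i (x ∷ [])     = refl
DESfrom-map f-mono i (x ∷ y ∷ xs) =
  cong₂ (λ b rest → singletonIf b i ++ rest) (<ᵇ-preserved f-mono x y) (DESfrom-map f-mono (suc i) (y ∷ xs))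

lastOr : ℕ → List ℕ → ℕ
lastOr z []       = z
lastOr z (w ∷ ws) = lastOr w ws

lastOr-∷ʳ : ∀ z ws x → lastOr z (ws ∷ʳ x) ≡ x
lastOr-∷ʳ z []       x = refl
lastOr-∷ʳ z (w ∷ ws) x = lastOr-∷ʳ w ws x

DESfrom-∷-∷ʳ : ∀ i z ws y →
  DESfrom i (z ∷ ws ∷ʳ y) ≡ DESfrom i (z ∷ ws) ++ singletonIf (y <ᵇ lastOr z ws) (i + length ws)
DESfrom-∷-∷ʳ i z [] y rewrite +-identityʳ i = ++-identityʳ _
DESfrom-∷-∷ʳ i z (w ∷ ws) y rewrite DESfrom-∷-∷ʳ (suc i) w ws y | +-suc i (length ws) =
  sym (++-assoc (singletonIf (w <ᵇ z) i) (DESfrom (suc i) (w ∷ ws)) _)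

DESfrom-∷ʳ : ∀ i ws x y →
  DESfrom i (ws ∷ʳ x ∷ʳ y) ≡ DESfrom i (ws ∷ʳ x) ++ singletonIf (y <ᵇ x) (i + length ws)
DESfrom-∷ʳ i []       x y = DESfrom-∷-∷ʳ i x [] y
DESfrom-∷ʳ i (z ∷ zs) x y
  rewrite DESfrom-∷-∷ʳ i z (zs ∷ʳ x) y | lastOr-∷ʳ z zs x | length-++ zs {x ∷ []} | +-comm (length zs) 1
  = refl

growthDES : ℕ → ℕ → List ℕ → List ℕ
growthDES prev i []       = []
growthDES prev i (p ∷ ps) = singletonIf (p <ᵇ suc prev) i ++ growthDES p (suc i) ps

GrowthFrom : ℕ → List ℕ → Set
GrowthFrom i []       = ⊤
GrowthFrom i (p ∷ ps) = p ≤ 2 * i × GrowthFrom (suc i) ps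

growthFrom-toList : ∀ i {n} (v : Vec ℕ n) →
  ((k : Fin n) → lookup v k ≤ 2 * (i + toℕ k)) → GrowthFrom i (toList v)
growthFrom-toList i []      bound = tt
growthFrom-toList i (x ∷ v) bound =
  subst (λ j → x ≤ 2 * j) (+-identityʳ i) (bound Fin.zero) ,
  growthFrom-toList (suc i) v (λ k → subst (λ j → lookup v k ≤ 2 * j) (+-suc i (toℕ k)) (bound (Fin.suc k)))

2*suc : ∀ i → 2 * suc i ≡ suc (suc (2 * i))
2*suc i = *-suc 2 i

applyUpTo-cong< : ∀ {A : Set} {f g : ℕ → A} n → (∀ x → x < n → f x ≡ g x) → applyUpTo f n ≡ applyUpTo g n
applyUpTo-cong< zero    f≡g = refl
applyUpTo-cong< (suc n) f≡g = cong₂ _∷_ (f≡g 0 z<s) (applyUpTo-cong< n (λ x x<n → f≡g (suc x) (s<s x<n)))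

-- Min-words of matchings

Pair : Set
Pair = ℕ × ℕ

Ordered : Pair → Set
Ordered ab = proj₁ ab < proj₂ ab

minsAt : Matching → ℕ → List ℕ
minsAt m k = map (λ ab → proj₁ ab ⊓ proj₂ ab) (filterᵇ (λ ab → (proj₁ ab ⊔ proj₂ ab) ≡ᵇ k) m)

All-reverse : ∀ {A : Set} {P : A → Set} {xs} → All P xs → All P (reverse xs)
All-reverse {xs = []}     []         = []
All-reverse {xs = x ∷ xs} (px ∷ pxs) rewrite unfold-reverse x xs = All.++⁺ (All-reverse pxs) (px ∷ [])

minsAt-++ : ∀ m m′ k → minsAt (m ++ m′) k ≡ minsAt m k ++ minsAt m′ k
minsAt-++ m m′ k = trans (cong (map _) (filter-++ _ m m′)) (map-++ _ (filterᵇ _ m) _)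

minsAt-none : ∀ {m k} → All (λ ab → Ordered ab × proj₂ ab ≢ k) m → minsAt m k ≡ []
minsAt-none {m} {k} avoid = cong (map _) (filter-none _ (All.map notKey avoid))
  where
  notKey : ∀ {ab} → Ordered ab × proj₂ ab ≢ k → ¬ T ((proj₁ ab ⊔ proj₂ ab) ≡ᵇ k)
  notKey (a<b , b≢k) t = b≢k (trans (sym (m≤n⇒m⊔n≡n (<⇒≤ a<b))) (≡ᵇ⇒≡ _ _ t))

minsAt-single : ∀ ab → Ordered ab → minsAt (ab ∷ []) (proj₂ ab) ≡ proj₁ ab ∷ []
minsAt-single ab a<b rewrite m≤n⇒m⊔n≡n (<⇒≤ a<b) | ≡ᵇ-refl (proj₂ ab) | m≤n⇒m⊓n≡m (<⇒≤ a<b) = refl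

reverse-∷-++ : ∀ {A : Set} (y : A) ys zs → reverse (y ∷ ys) ++ zs ≡ reverse ys ++ y ∷ zs
reverse-∷-++ y ys zs = trans (cong (_++ zs) (unfold-reverse y ys)) (++-assoc (reverse ys) (y ∷ []) zs)

applyUpTo-+-suc : ∀ lo L → applyUpTo (lo +_) (suc L) ≡ lo ∷ applyUpTo (suc lo +_) L
applyUpTo-+-suc lo L = cong₂ _∷_ (+-identityʳ lo) (applyUpTo-cong< L (λ x _ → +-suc lo x))

KeysIn : ℕ → ℕ → List Pair → Set
KeysIn lo hi = All (λ ab → lo ≤ proj₂ ab × proj₂ ab < hi)

Sorted : List Pair → Set
Sorted = AllPairs (_<_ on proj₂)

-- Scanning the keys lo, lo+1, … picks up the pairs of xs one by one; junk collects the pairs already read.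
concatMap-minsAt-sorted : ∀ L lo xs junk → Sorted xs → All Ordered xs → KeysIn lo (lo + L) xs →
  All (λ ab → Ordered ab × proj₂ ab < lo) junk →
  concatMap (minsAt (reverse xs ++ junk)) (applyUpTo (lo +_) L) ≡ map proj₁ xs
concatMap-minsAt-sorted zero lo [] junk _ _ _ _ = refl
concatMap-minsAt-sorted zero lo (x ∷ xs) junk _ _ ((lo≤x , x<lo+0) ∷ _) _ =
  ⊥-elim (<⇒≱ x<lo+0 (subst (_≤ proj₂ x) (sym (+-identityʳ lo)) lo≤x))
concatMap-minsAt-sorted (suc L) lo xs junk sorted ord keys old =
  trans (cong (concatMap (minsAt (reverse xs ++ junk))) (applyUpTo-+-suc lo L)) (scan xs sorted ord keys)
  where
  old′ : All (λ ab → Ordered ab × proj₂ ab < suc lo) junk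
  old′ = All.map (λ (a<b , b<lo) → a<b , m<n⇒m<1+n b<lo) old
  shift : ∀ {k} → k < lo + suc L → k < suc lo + L
  shift {k} = subst (k <_) (+-suc lo L)
  scan : ∀ xs → Sorted xs → All Ordered xs → KeysIn lo (lo + suc L) xs →
    minsAt (reverse xs ++ junk) lo ++ concatMap (minsAt (reverse xs ++ junk)) (applyUpTo (suc lo +_) L) ≡ map proj₁ xs
  scan [] _ _ _ =
    cong₂ _++_ (minsAt-none (All.map (λ (a<b , b<lo) → a<b , λ b≡lo → <-irrefl b≡lo b<lo) old))
               (concatMap-minsAt-sorted L (suc lo) [] junk [] [] [] old′)
  scan (y ∷ ys) (y<ys ∷ sorted) (ordy ∷ ord) ((lo≤y , y<) ∷ keys) with m≤n⇒m<n∨m≡n lo≤y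
  ... | inj₂ refl rewrite reverse-∷-++ y ys junk
                        | minsAt-++ (reverse ys) (y ∷ junk) lo | minsAt-++ (y ∷ []) junk lo
                        | minsAt-none {reverse ys} {lo} (All-reverse (All.zipWith (λ (y<z , ordz) → ordz , λ z≡y → <-irrefl (sym z≡y) y<z) (y<ys , ord)))
                        | minsAt-single y ordy
                        | minsAt-none {junk} {lo} (All.map (λ (a<b , b<y) → a<b , λ b≡y → <-irrefl b≡y b<y) old) =
    cong (proj₁ y ∷_) (concatMap-minsAt-sorted L (suc lo) ys (y ∷ junk) sorted ord
      (All.zipWith (λ (y<z , (_ , z<)) → y<z , shift z<) (y<ys , keys))
      ((ordy , ≤-refl) ∷ old′))
  ... | inj₁ lo<y = cong₂ _++_
    (minsAt-none (All.++⁺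
      (All-reverse ((ordy , λ y≡lo → <-irrefl (sym y≡lo) lo<y) ∷
        All.zipWith (λ (y<z , ordz) → ordz , λ z≡lo → <-irrefl (sym z≡lo) (<-trans lo<y y<z)) (y<ys , ord)))
      (All.map (λ (a<b , b<lo) → a<b , λ b≡lo → <-irrefl b≡lo b<lo) old)))
    (concatMap-minsAt-sorted L (suc lo) (y ∷ ys) junk (y<ys ∷ sorted) (ordy ∷ ord)
      ((lo<y , shift y<) ∷
        All.zipWith (λ (y<z , (_ , z<)) → <-trans lo<y y<z , shift z<) (y<ys , keys))
      old′)

shiftAbove-mono : ∀ p → shiftAbove p Preserves _<_ ⟶ _<_
shiftAbove-mono p {x} {y} x<y with p <ᵇ x in p<ᵇx | p <ᵇ y in p<ᵇy
... | true  | true  = s≤s x<y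
... | false | false = x<y
... | false | true  = m<n⇒m<1+n x<y
... | true  | false = ⊥-elim (<⇒≱ (<-trans (<ᵇ≡true⇒< p<ᵇx) x<y) (<ᵇ≡false⇒≥ p<ᵇy))

shiftAbove-≤ : ∀ p x → shiftAbove p x ≤ suc x
shiftAbove-≤ p x with p <ᵇ x
... | true  = ≤-refl
... | false = n≤1+n x

shiftPair : ℕ → Pair → Pair
shiftPair p ab = shiftAbove p (proj₁ ab) , shiftAbove p (proj₂ ab)

-- The pairs of match in order of insertion: match (p₁ … pᵢ) is the reverse of this list.
insertPair : ℕ → ℕ → List Pair → List Pair
insertPair p i xs = map (shiftPair p) xs ∷ʳ (suc p , 2 * suc i)

reverse-insertPair : ∀ p i xs → (suc p , 2 * suc i) ∷ map (shiftPair p) (reverse xs) ≡ reverse (insertPair p i xs)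
reverse-insertPair p i xs rewrite reverse-++ (map (shiftPair p) xs) ((suc p , 2 * suc i) ∷ []) | reverse-map (shiftPair p) xs = refl

record WellFormed (i : ℕ) (xs : List Pair) : Set where
  field
    length≡ : length xs ≡ i
    ordered : All Ordered xs
    sorted  : Sorted xs
    bounded : All (λ ab → proj₂ ab ≤ 2 * i) xs

minWord-reverse : ∀ {i xs} → WellFormed i xs → minWord (reverse xs) ≡ map proj₁ xs
minWord-reverse {i} {xs} wf rewrite length-reverse xs | WellFormed.length≡ wf =
  subst (λ m → concatMap (minsAt m) (applyUpTo suc (2 * i)) ≡ map proj₁ xs) (++-identityʳ (reverse xs))
    (concatMap-minsAt-sorted (2 * i) 1 xs [] sorted ordered
      (All.zipWith (λ (a<b , b≤) → <-≤-trans z<s a<b , s≤s b≤) (ordered , bounded)) [])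
  where open WellFormed wf

WellFormed-insert : ∀ {p i xs} → p ≤ 2 * i → WellFormed i xs → WellFormed (suc i) (insertPair p i xs)
WellFormed-insert {p} {i} {xs} p≤ wf = record
  { length≡ = trans (length-++ (map (shiftPair p) xs)) (trans (cong (_+ 1) (trans (length-map _ xs) length≡)) (+-comm i 1))
  ; ordered = All.∷ʳ⁺ (All.map⁺ (All.map (shiftAbove-mono p) ordered)) newOrdered
  ; sorted  = AllPairs.++⁺ (AllPairs.map⁺ (AllPairs.map (shiftAbove-mono p) sorted)) ([] ∷ [])
                (All.map⁺ (All.map (λ b≤ → belowNew b≤ ∷ []) bounded))
  ; bounded = All.∷ʳ⁺ (All.map⁺ (All.map (λ b≤ → <⇒≤ (belowNew b≤)) bounded)) ≤-refl
  }
  where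
  open WellFormed wf
  newOrdered : suc p < 2 * suc i
  newOrdered rewrite 2*suc i = s≤s (s≤s p≤)
  belowNew : ∀ {b} → b ≤ 2 * i → shiftAbove p b < 2 * suc i
  belowNew {b} b≤ rewrite 2*suc i = s≤s (≤-trans (shiftAbove-≤ p b) (s≤s b≤))

mins-insertPair : ∀ p i xs → map proj₁ (insertPair p i xs) ≡ map (shiftAbove p) (map proj₁ xs) ∷ʳ suc p
mins-insertPair p i xs rewrite map-++ proj₁ (map (shiftPair p) xs) ((suc p , 2 * suc i) ∷ [])
                             | sym (map-∘ {g = proj₁} {f = shiftPair p} xs)
                             | sym (map-∘ {g = shiftAbove p} {f = proj₁} xs) = refl

DES-map-∷ʳ : ∀ {f} → f Preserves _<_ ⟶ _<_ → ∀ ws x y →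
  DES (map f (ws ∷ʳ x) ∷ʳ y) ≡ DES (ws ∷ʳ x) ++ singletonIf (y <ᵇ f x) (suc (length ws))
DES-map-∷ʳ {f} f-mono ws x y = begin
    DES (map f (ws ∷ʳ x) ∷ʳ y)
  ≡⟨ cong (λ w → DES (w ∷ʳ y)) (map-++ f ws (x ∷ [])) ⟩
    DES (map f ws ∷ʳ f x ∷ʳ y)
  ≡⟨ DESfrom-∷ʳ 1 (map f ws) (f x) y ⟩
    DES (map f ws ∷ʳ f x) ++ singletonIf (y <ᵇ f x) (suc (length (map f ws)))
  ≡⟨ cong₂ _++_ (trans (cong DES (sym (map-++ f ws (x ∷ [])))) (DESfrom-map f-mono 1 (ws ∷ʳ x)))
                (cong (singletonIf (y <ᵇ f x)) (cong suc (length-map f ws))) ⟩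
    DES (ws ∷ʳ x) ++ singletonIf (y <ᵇ f x) (suc (length ws))
  ∎
  where open ≡-Reasoning

newMin<ᵇ : ∀ p prev → (suc p <ᵇ shiftAbove p (suc prev)) ≡ (p <ᵇ suc prev)
newMin<ᵇ p prev with p <ᵇ suc prev in p<ᵇ
... | true  = <ᵇ-true {suc p} {suc (suc prev)} (s≤s (<ᵇ≡true⇒< p<ᵇ))
... | false = <ᵇ-false {p} {prev} (≤-trans (n≤1+n prev) (<ᵇ≡false⇒≥ p<ᵇ))

DES-minWord-matchGo : ∀ ps {i xs prev ws} → WellFormed i xs → map proj₁ xs ≡ ws ∷ʳ suc prev → GrowthFrom i ps →
  DES (minWord (matchGo i (reverse xs) ps)) ≡ DES (map proj₁ xs) ++ growthDES prev i ps
DES-minWord-matchGo [] wf _ _ rewrite minWord-reverse wf = sym (++-identityʳ _)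
DES-minWord-matchGo (p ∷ ps) {i} {xs} {prev} {ws} wf mins≡ (p≤ , growth) = begin
    DES (minWord (matchGo (suc i) ((suc p , 2 * suc i) ∷ map (shiftPair p) (reverse xs)) ps))
  ≡⟨ cong (λ m → DES (minWord (matchGo (suc i) m ps))) (reverse-insertPair p i xs) ⟩
    DES (minWord (matchGo (suc i) (reverse (insertPair p i xs)) ps))
  ≡⟨ DES-minWord-matchGo ps (WellFormed-insert p≤ wf) newMins-unfolded growth ⟩
    DES (map proj₁ (insertPair p i xs)) ++ growthDES p (suc i) ps
  ≡⟨ cong (λ w → DES w ++ growthDES p (suc i) ps) newMins ⟩
    DES (map (shiftAbove p) (ws ∷ʳ suc prev) ∷ʳ suc p) ++ growthDES p (suc i) ps
  ≡⟨ cong (_++ growthDES p (suc i) ps) (DES-map-∷ʳ (shiftAbove-mono p) ws (suc prev) (suc p)) ⟩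
    (DES (ws ∷ʳ suc prev) ++ singletonIf (suc p <ᵇ shiftAbove p (suc prev)) (suc (length ws))) ++ growthDES p (suc i) ps
  ≡⟨ cong (λ b → (DES (ws ∷ʳ suc prev) ++ singletonIf b (suc (length ws))) ++ growthDES p (suc i) ps) (newMin<ᵇ p prev) ⟩
    (DES (ws ∷ʳ suc prev) ++ singletonIf (p <ᵇ suc prev) (suc (length ws))) ++ growthDES p (suc i) ps
  ≡⟨ ++-assoc (DES (ws ∷ʳ suc prev)) _ _ ⟩
    DES (ws ∷ʳ suc prev) ++ singletonIf (p <ᵇ suc prev) (suc (length ws)) ++ growthDES p (suc i) ps
  ≡⟨ cong₂ (λ w k → DES w ++ singletonIf (p <ᵇ suc prev) k ++ growthDES p (suc i) ps) (sym mins≡) length≡ ⟩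
    DES (map proj₁ xs) ++ growthDES prev i (p ∷ ps)
  ∎
  where
  open ≡-Reasoning
  newMins : map proj₁ (insertPair p i xs) ≡ map (shiftAbove p) (ws ∷ʳ suc prev) ∷ʳ suc p
  newMins = trans (mins-insertPair p i xs) (cong (λ w → map (shiftAbove p) w ∷ʳ suc p) mins≡)
  newMins-unfolded : map proj₁ (insertPair p i xs) ≡ map (shiftAbove p) ws ∷ʳ shiftAbove p (suc prev) ∷ʳ suc p
  newMins-unfolded = trans newMins (cong (_∷ʳ suc p) (map-++ (shiftAbove p) ws (suc prev ∷ [])))
  length≡ : suc (length ws) ≡ i
  length≡ = begin
    suc (length ws)             ≡⟨ +-comm 1 (length ws) ⟩
    length ws + 1               ≡⟨ length-++ ws ⟨
    length (ws ∷ʳ suc prev)     ≡⟨ cong length mins≡ ⟨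
    length (map proj₁ xs)       ≡⟨ length-map proj₁ xs ⟩
    length xs                   ≡⟨ WellFormed.length≡ wf ⟩
    i                           ∎

-- The labelled Dyck word and σ

ups : List Letter → ℕ
ups []           = 0
ups (up _ ∷ w)   = suc (ups w)
ups (down _ ∷ w) = ups w

hasUp : ℕ → List Letter → Bool
hasUp j []           = false
hasUp j (up k ∷ w)   = if k ≡ᵇ j then true else hasUp j w
hasUp j (down _ ∷ w) = hasUp j w

upsBefore-++ : ∀ j X Y → upsBefore j (X ++ Y) ≡ (if hasUp j X then upsBefore j X else ups X + upsBefore j Y)
upsBefore-++ j []           Y = refl
upsBefore-++ j (down _ ∷ X) Y = upsBefore-++ j X Y
upsBefore-++ j (up k ∷ X)   Y with k ≡ᵇ j
... | true  = refl
... | false rewrite upsBefore-++ j X Y with hasUp j X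
...   | true  = refl
...   | false = refl

upsBefore-at : ∀ j A B → hasUp j A ≡ false → upsBefore j (A ++ up j ∷ B) ≡ ups A
upsBefore-at j A B j∉A rewrite upsBefore-++ j A (up j ∷ B) | j∉A | ≡ᵇ-refl j = +-identityʳ (ups A)

upsBefore<ups : ∀ j X → hasUp j X ≡ true → upsBefore j X < ups X
upsBefore<ups j (down _ ∷ X) j∈X = upsBefore<ups j X j∈X
upsBefore<ups j (up k ∷ X)   j∈X with k ≡ᵇ j
... | true  = s≤s z≤n
... | false = s≤s (upsBefore<ups j X j∈X)

-- Inserting an up step after q earlier up steps moves every later up step one place to the right.
shiftFrom : ℕ → ℕ → ℕ
shiftFrom q r = if r <ᵇ q then r else suc r

shiftFrom-mono : ∀ q → shiftFrom q Preserves _<_ ⟶ _<_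
shiftFrom-mono q {x} {y} x<y with x <ᵇ q in x<ᵇq | y <ᵇ q in y<ᵇq
... | true  | true  = x<y
... | false | false = s≤s x<y
... | true  | false = m<n⇒m<1+n x<y
... | false | true  = ⊥-elim (<⇒≱ (<-trans x<y (<ᵇ≡true⇒< {y} {q} y<ᵇq)) (<ᵇ≡false⇒≥ {x} {q} x<ᵇq))

upsBefore-insertUD : ∀ j c p w → j ≢ c → upsBefore j (insertUD p c w) ≡ shiftFrom (ups (take p w)) (upsBefore j w)
upsBefore-insertUD j c p w j≢c = begin
    upsBefore j (X ++ up c ∷ down c ∷ Y)
  ≡⟨ shifted ⟩
    shiftFrom (ups X) (upsBefore j (X ++ Y))
  ≡⟨ cong (λ v → shiftFrom (ups X) (upsBefore j v)) (take++drop≡id p w) ⟩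
    shiftFrom (ups X) (upsBefore j w)
  ∎
  where
  open ≡-Reasoning
  X = take p w
  Y = drop p w
  shifted : upsBefore j (X ++ up c ∷ down c ∷ Y) ≡ shiftFrom (ups X) (upsBefore j (X ++ Y))
  shifted rewrite upsBefore-++ j X (up c ∷ down c ∷ Y) | upsBefore-++ j X Y with hasUp j X in j∈X
  ... | true  rewrite <ᵇ-true (upsBefore<ups j X j∈X) = refl
  ... | false rewrite ≡ᵇ-false {c} {j} (λ c≡j → j≢c (sym c≡j)) | <ᵇ-false {ups X + upsBefore j Y} {ups X} (m≤m+n _ _) =
    +-suc _ _

ups-take-≤ : ∀ p A Y → p ≤ length A → ups (take p (A ++ Y)) ≤ ups A
ups-take-≤ zero    A            Y _         = z≤n
ups-take-≤ (suc p) (up _ ∷ A)   Y (s≤s p≤A) = s≤s (ups-take-≤ p A Y p≤A)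
ups-take-≤ (suc p) (down _ ∷ A) Y (s≤s p≤A) = ups-take-≤ p A Y p≤A

ups-take-> : ∀ p A k B → length A < p → ups A < ups (take p (A ++ up k ∷ B))
ups-take-> (suc p) []           k B _         = s≤s z≤n
ups-take-> (suc p) (up _ ∷ A)   k B (s≤s A<p) = s≤s (ups-take-> p A k B A<p)
ups-take-> (suc p) (down _ ∷ A) k B (s≤s A<p) = ups-take-> p A k B A<p

hasUp-insertUD : ∀ j c p w → hasUp j (insertUD p c w) ≡ (c ≡ᵇ j) ∨ hasUp j w
hasUp-insertUD j c zero w with c ≡ᵇ j
... | true  = refl
... | false = refl
hasUp-insertUD j c (suc p) [] with c ≡ᵇ j
... | true  = refl
... | false = refl
hasUp-insertUD j c (suc p) (down _ ∷ w) = hasUp-insertUD j c p w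
hasUp-insertUD j c (suc p) (up k ∷ w) rewrite hasUp-insertUD j c p w with k ≡ᵇ j | c ≡ᵇ j
... | true  | true  = refl
... | true  | false = refl
... | false | _     = refl

hasUp-take : ∀ j p w → hasUp j w ≡ false → hasUp j (take p w) ≡ false
hasUp-take j zero    w            _   = refl
hasUp-take j (suc p) []           _   = refl
hasUp-take j (suc p) (down _ ∷ w) j∉w = hasUp-take j p w j∉w
hasUp-take j (suc p) (up k ∷ w)   j∉w with k ≡ᵇ j
hasUp-take j (suc p) (up k ∷ w) () | true
... | false = hasUp-take j p w j∉w

length-insertUD : ∀ p c (w : List Letter) → length (insertUD p c w) ≡ suc (suc (length w))
length-insertUD zero    c w       = refl
length-insertUD (suc p) c []      = refl
length-insertUD (suc p) c (_ ∷ w) = cong suc (length-insertUD p c w)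

-- upPositions W n lists, for the chords 1 … n, the number of up steps left of their up step, i.e. σ - 1.
upPositions : List Letter → ℕ → List ℕ
upPositions W n = applyUpTo (λ x → upsBefore (suc x) W) n

-- W carries the chords 1 … i, and the up step of the newest chord i was inserted at position prev.
record Labeled (i : ℕ) (W : List Letter) (prev : ℕ) : Set where
  field
    A B      : List Letter
    length≡  : length W ≡ 2 * i
    fresh    : ∀ c → i < c → hasUp c W ≡ false
    split    : W ≡ A ++ up i ∷ B
    lengthA  : length A ≡ prev
    i∉A      : hasUp i A ≡ false

Labeled-insert : ∀ {i W prev p} → p ≤ 2 * i → Labeled i W prev → Labeled (suc i) (insertUD p (suc i) W) p
Labeled-insert {i} {W} {prev} {p} p≤ lab = record
  { A       = take p W
  ; B       = down (suc i) ∷ drop p W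
  ; length≡ = trans (length-insertUD p (suc i) W) (trans (cong (λ n → suc (suc n)) length≡) (sym (2*suc i)))
  ; fresh   = λ c i<c → trans (hasUp-insertUD c (suc i) p W)
                  (trans (cong (_∨ hasUp c W) (≡ᵇ-false (λ c≡ → <-irrefl c≡ i<c))) (fresh c (<-trans (n<1+n i) i<c)))
  ; split   = refl
  ; lengthA = trans (length-take p W) (m≤n⇒m⊓n≡m (subst (p ≤_) (sym length≡) p≤))
  ; i∉A     = hasUp-take (suc i) p W (fresh (suc i) ≤-refl)
  }
  where open Labeled lab

-- The up step of the new chord comes before that of the previous chord exactly when p ≤ prev.
newUp<ᵇ : ∀ {i W prev} p (lab : Labeled i W prev) →
  (ups (take p W) <ᵇ shiftFrom (ups (take p W)) (ups (Labeled.A lab))) ≡ (p <ᵇ suc prev)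
newUp<ᵇ {i} {W} {prev} p lab with p <ᵇ suc prev in p<ᵇ
... | true = trans (cong (q <ᵇ_) shifted) (<ᵇ-true (s≤s q≤A))
  where
  open Labeled lab
  q = ups (take p W)
  q≤A : q ≤ ups A
  q≤A = subst (λ v → ups (take p v) ≤ ups A) (sym split)
          (ups-take-≤ p A (up i ∷ B) (subst (p ≤_) (sym lengthA) (≤-pred (<ᵇ≡true⇒< p<ᵇ))))
  shifted : shiftFrom q (ups A) ≡ suc (ups A)
  shifted rewrite <ᵇ-false q≤A = refl
... | false = trans (cong (q <ᵇ_) shifted) (<ᵇ-false (<⇒≤ A<q))
  where
  open Labeled lab
  q = ups (take p W)
  A<q : ups A < q
  A<q = subst (λ v → ups A < ups (take p v)) (sym split)
          (ups-take-> p A i B (subst (_< p) (sym lengthA) (<ᵇ≡false⇒≥ p<ᵇ)))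
  shifted : shiftFrom q (ups A) ≡ ups A
  shifted rewrite <ᵇ-true A<q = refl

upPositions-last : ∀ {i W prev} (lab : Labeled (suc i) W prev) →
  upPositions W (suc i) ≡ upPositions W i ∷ʳ ups (Labeled.A lab)
upPositions-last {i} {W} lab = trans (sym (applyUpTo-∷ʳ (λ x → upsBefore (suc x) W) i)) (cong (upPositions W i ∷ʳ_) last≡)
  where
  open Labeled lab
  last≡ : upsBefore (suc i) W ≡ ups A
  last≡ rewrite split = upsBefore-at (suc i) A B i∉A

upPositions-insertUD : ∀ {i W prev} p (lab : Labeled (suc i) W prev) →
  upPositions (insertUD p (suc (suc i)) W) (suc (suc i))
    ≡ map (shiftFrom (ups (take p W))) (upPositions W i ∷ʳ ups (Labeled.A lab)) ∷ʳ ups (take p W)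
upPositions-insertUD {i} {W} p lab = begin
    upPositions W′ (suc (suc i))
  ≡⟨ applyUpTo-∷ʳ (λ x → upsBefore (suc x) W′) (suc i) ⟨
    upPositions W′ (suc i) ∷ʳ upsBefore (suc (suc i)) W′
  ≡⟨ cong₂ _∷ʳ_ older newest ⟩
    map (shiftFrom q) (upPositions W (suc i)) ∷ʳ q
  ≡⟨ cong (λ v → map (shiftFrom q) v ∷ʳ q) (upPositions-last lab) ⟩
    map (shiftFrom q) (upPositions W i ∷ʳ ups A) ∷ʳ q
  ∎
  where
  open ≡-Reasoning
  open Labeled lab
  W′ = insertUD p (suc (suc i)) W
  q  = ups (take p W)
  older : upPositions W′ (suc i) ≡ map (shiftFrom q) (upPositions W (suc i))
  older = trans (applyUpTo-cong< (suc i) (λ x x<i → upsBefore-insertUD (suc x) (suc (suc i)) p W (λ x≡ → <-irrefl (suc-injective x≡) x<i)))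
                (sym (map-applyUpTo (λ x → upsBefore (suc x) W) (shiftFrom q) (suc i)))
  newest : upsBefore (suc (suc i)) W′ ≡ q
  newest = upsBefore-at (suc (suc i)) (take p W) (down (suc (suc i)) ∷ drop p W) (hasUp-take (suc (suc i)) p W (fresh (suc (suc i)) ≤-refl))

DES-upPositions-insertUD : ∀ {i W prev} p (lab : Labeled (suc i) W prev) →
  DES (upPositions (insertUD p (suc (suc i)) W) (suc (suc i))) ≡ DES (upPositions W (suc i)) ++ singletonIf (p <ᵇ suc prev) (suc i)
DES-upPositions-insertUD {i} {W} {prev} p lab = begin
    DES (upPositions (insertUD p (suc (suc i)) W) (suc (suc i)))
  ≡⟨ cong DES (upPositions-insertUD p lab) ⟩
    DES (map (shiftFrom q) (upPositions W i ∷ʳ ups A) ∷ʳ q)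
  ≡⟨ DES-map-∷ʳ (shiftFrom-mono q) (upPositions W i) (ups A) q ⟩
    DES (upPositions W i ∷ʳ ups A) ++ singletonIf (q <ᵇ shiftFrom q (ups A)) (suc (length (upPositions W i)))
  ≡⟨ cong₂ (λ w b → DES w ++ singletonIf b (suc (length (upPositions W i)))) (sym (upPositions-last lab)) (newUp<ᵇ p lab) ⟩
    DES (upPositions W (suc i)) ++ singletonIf (p <ᵇ suc prev) (suc (length (upPositions W i)))
  ≡⟨ cong (λ k → DES (upPositions W (suc i)) ++ singletonIf (p <ᵇ suc prev) (suc k)) (length-applyUpTo _ i) ⟩
    DES (upPositions W (suc i)) ++ singletonIf (p <ᵇ suc prev) (suc i)
  ∎
  where
  open ≡-Reasoning
  open Labeled lab
  q = ups (take p W)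

DES-upPositions-labeledGo : ∀ ps {i W prev} → Labeled (suc i) W prev → GrowthFrom (suc i) ps →
  DES (upPositions (labeledGo (suc i) W ps) (suc i + length ps)) ≡ DES (upPositions W (suc i)) ++ growthDES prev (suc i) ps
DES-upPositions-labeledGo [] {i} _ _ rewrite +-identityʳ i = sym (++-identityʳ _)
DES-upPositions-labeledGo (p ∷ ps) {i} {W} {prev} lab (p≤ , growth) = begin
    DES (upPositions (labeledGo (suc (suc i)) W′ ps) (suc i + suc (length ps)))
  ≡⟨ cong (λ n → DES (upPositions (labeledGo (suc (suc i)) W′ ps) n)) (+-suc (suc i) (length ps)) ⟩
    DES (upPositions (labeledGo (suc (suc i)) W′ ps) (suc (suc i) + length ps))
  ≡⟨ DES-upPositions-labeledGo ps (Labeled-insert p≤ lab) growth ⟩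
    DES (upPositions W′ (suc (suc i))) ++ growthDES p (suc (suc i)) ps
  ≡⟨ cong (_++ growthDES p (suc (suc i)) ps) (DES-upPositions-insertUD p lab) ⟩
    (DES (upPositions W (suc i)) ++ singletonIf (p <ᵇ suc prev) (suc i)) ++ growthDES p (suc (suc i)) ps
  ≡⟨ ++-assoc (DES (upPositions W (suc i))) _ _ ⟩
    DES (upPositions W (suc i)) ++ growthDES prev (suc i) (p ∷ ps)
  ∎
  where
  open ≡-Reasoning
  W′ = insertUD p (suc (suc i)) W

-- Columns and paths given by heights

≤ᵇᶻ-reflects : ∀ x y → Reflects (x ℤ.≤ y) (x ℤ.≤ᵇ y)
≤ᵇᶻ-reflects x y = fromEquivalence ℤ.≤ᵇ⇒≤ ℤ.≤⇒≤ᵇ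

<ᶻ-reflects : ∀ x y → Reflects (x ℤ.< y) (x <ᶻ y)
<ᶻ-reflects x y = reflects-⇔
  (λ x+1≤y → ℤ.suc[i]≤j⇒i<j (subst (ℤ._≤ y) (ℤ.+-comm x 1ℤ) x+1≤y))
  (λ x<y → subst (ℤ._≤ y) (ℤ.+-comm 1ℤ x) (ℤ.i<j⇒suc[i]≤j x<y))
  (≤ᵇᶻ-reflects (x ℤ.+ 1ℤ) y)

==ᶻ-reflects : ∀ x y → Reflects (x ≡ y) (x ==ᶻ y)
==ᶻ-reflects x y = reflects-⇔
  (λ (x≤y , y≤x) → ℤ.≤-antisym x≤y y≤x)
  (λ { refl → ℤ.≤-refl , ℤ.≤-refl })
  (≤ᵇᶻ-reflects x y ×-reflects ≤ᵇᶻ-reflects y x)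

<ᶻ-true : ∀ {x y} → x ℤ.< y → (x <ᶻ y) ≡ true
<ᶻ-true = yes⇒true (<ᶻ-reflects _ _)

<ᶻ-false : ∀ {x y} → y ℤ.≤ x → (x <ᶻ y) ≡ false
<ᶻ-false y≤x = no⇒false (<ᶻ-reflects _ _) (ℤ.≤⇒≯ y≤x)

<ᶻ≡true⇒< : ∀ {x y} → (x <ᶻ y) ≡ true → x ℤ.< y
<ᶻ≡true⇒< = true⇒yes (<ᶻ-reflects _ _)

<ᶻ≡false⇒≥ : ∀ {x y} → (x <ᶻ y) ≡ false → y ℤ.≤ x
<ᶻ≡false⇒≥ x<ᶻy = ℤ.≮⇒≥ (false⇒no (<ᶻ-reflects _ _) x<ᶻy)

==ᶻ-refl : ∀ x → (x ==ᶻ x) ≡ true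
==ᶻ-refl x = yes⇒true (==ᶻ-reflects x x) refl

==ᶻ-false : ∀ {x y} → x ≢ y → (x ==ᶻ y) ≡ false
==ᶻ-false = no⇒false (==ᶻ-reflects _ _)

==ᶻ≡true⇒≡ : ∀ {x y} → (x ==ᶻ y) ≡ true → x ≡ y
==ᶻ≡true⇒≡ = true⇒yes (==ᶻ-reflects _ _)

+-cancelʳ : ∀ x c → (x ℤ.+ c) ℤ.- c ≡ x
+-cancelʳ = solve-∀

+-<ᶻ : ∀ x y c → ((x ℤ.+ c) <ᶻ (y ℤ.+ c)) ≡ (x <ᶻ y)
+-<ᶻ x y c = det (<ᶻ-reflects (x ℤ.+ c) (y ℤ.+ c)) (reflects-⇔
  (ℤ.+-monoˡ-< c)
  (λ lt → subst₂ ℤ._<_ (+-cancelʳ x c) (+-cancelʳ y c) (ℤ.+-monoˡ-< (ℤ.- c) lt))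
  (<ᶻ-reflects x y))

+-==ᶻ : ∀ x y c → ((x ℤ.+ c) ==ᶻ (y ℤ.+ c)) ≡ (x ==ᶻ y)
+-==ᶻ x y c = det (==ᶻ-reflects (x ℤ.+ c) (y ℤ.+ c)) (reflects-⇔
  (cong (ℤ._+ c))
  (λ eq → trans (sym (+-cancelʳ x c)) (trans (cong (ℤ._- c) eq) (+-cancelʳ y c)))
  (==ᶻ-reflects x y))

i<i+1 : ∀ x → x ℤ.< x ℤ.+ 1ℤ
i<i+1 x = ℤ.suc[i]≤j⇒i<j (ℤ.≤-reflexive (ℤ.+-comm 1ℤ x))

-- Column r of a path of order m, whose columns are numbered from -m.
col : ℕ → ℕ → ℤ
col m r = ℤ.+ r ℤ.- ℤ.+ m

col-suc-suc : ∀ m r → col (suc m) (suc r) ≡ col m r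
col-suc-suc m r = lemma (ℤ.+ r) (ℤ.+ m)
  where
  lemma : ∀ a b → (1ℤ ℤ.+ a) ℤ.- (1ℤ ℤ.+ b) ≡ a ℤ.- b
  lemma = solve-∀

col-+1 : ∀ m r → col m r ℤ.+ 1ℤ ≡ col m (suc r)
col-+1 m r = lemma (ℤ.+ r) (ℤ.+ m)
  where
  lemma : ∀ a b → (a ℤ.- b) ℤ.+ 1ℤ ≡ (1ℤ ℤ.+ a) ℤ.- b
  lemma = solve-∀

col-1 : ∀ m r → col m r ℤ.- 1ℤ ≡ col (suc m) r
col-1 m r = lemma (ℤ.+ r) (ℤ.+ m)
  where
  lemma : ∀ a b → (a ℤ.- b) ℤ.- 1ℤ ≡ a ℤ.- (1ℤ ℤ.+ b)
  lemma = solve-∀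

col+1≡col-suc : ∀ m r → col m r ℤ.+ 1ℤ ≡ col (suc m) (suc (suc r))
col+1≡col-suc m r = trans (col-+1 m r) (sym (col-suc-suc m (suc r)))

col-mono-≤ : ∀ m {r k} → r ≤ k → col m r ℤ.≤ col m k
col-mono-≤ m r≤k = ℤ.+-monoˡ-≤ (ℤ.- ℤ.+ m) (+≤+ r≤k)

col-mono-< : ∀ m {r k} → r < k → col m r ℤ.< col m k
col-mono-< m r<k = ℤ.+-monoˡ-< (ℤ.- ℤ.+ m) (+<+ r<k)

col-<ᶻ : ∀ m r k → (col m r <ᶻ col m k) ≡ (r <ᵇ k)
col-<ᶻ m r k = det (<ᶻ-reflects (col m r) (col m k)) (reflects-⇔
  (col-mono-< m)
  (λ lt → ≰⇒> (λ k≤r → ℤ.<⇒≱ lt (col-mono-≤ m k≤r)))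
  (<ᵇ-reflects-< r k))

col-==ᶻ : ∀ m r k → (col m r ==ᶻ col m k) ≡ (r ≡ᵇ k)
col-==ᶻ m r k = det (==ᶻ-reflects (col m r) (col m k)) (reflects-⇔ (cong (col m)) injective (≡ᵇ-reflects r k))
  where
  injective : col m r ≡ col m k → r ≡ k
  injective eq with <-cmp r k
  ... | tri< r<k _ _ = ⊥-elim (ℤ.<-irrefl eq (col-mono-< m r<k))
  ... | tri≈ _ r≡k _ = r≡k
  ... | tri> _ _ k<r = ⊥-elim (ℤ.<-irrefl (sym eq) (col-mono-< m k<r))

columnPath : ℕ → ℕ → List ℤ → Path
columnPath m r []       = []
columnPath m r (h ∷ hs) = (col m r , h) ∷ columnPath m (suc r) hs

-- Junk value 0 beyond the end of the list.
height : List ℤ → ℕ → ℤ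
height []       _       = 0ℤ
height (h ∷ hs) zero    = h
height (h ∷ hs) (suc r) = height hs r

insertPeak : ℕ → List ℤ → List ℤ
insertPeak _       []       = []
insertPeak zero    (h ∷ hs) = h ∷ h ℤ.+ 1ℤ ∷ h ∷ hs
insertPeak (suc k) (h ∷ hs) = h ∷ insertPeak k hs

spreadPt-< : ∀ m {k r} h → r < k → spreadPt (col m k) (col m r , h) ≡ (col (suc m) r , h) ∷ []
spreadPt-< m {k} {r} h r<k rewrite col-<ᶻ m r k | <ᵇ-true r<k | col-1 m r = refl

spreadPt-> : ∀ m {k r} h → k < r → spreadPt (col m k) (col m r , h) ≡ (col (suc m) (suc (suc r)) , h) ∷ []
spreadPt-> m {k} {r} h k<r
  rewrite col-<ᶻ m r k | <ᵇ-false (<⇒≤ k<r) | col-==ᶻ m r k | ≡ᵇ-false (λ r≡k → <-irrefl (sym r≡k) k<r)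
        | col+1≡col-suc m r = refl

spreadPt-≡ : ∀ m k h → spreadPt (col m k) (col m k , h)
  ≡ (col (suc m) k , h) ∷ (col (suc m) (suc k) , h ℤ.+ 1ℤ) ∷ (col (suc m) (suc (suc k)) , h) ∷ []
spreadPt-≡ m k h
  rewrite col-<ᶻ m k k | <ᵇ-false {k} ≤-refl | col-==ᶻ m k k | ≡ᵇ-refl k
        | col-1 m k | col+1≡col-suc m k | col-suc-suc m k = refl

spread-columnPath-> : ∀ m {k r} hs → k < r → spread (col m k) (columnPath m r hs) ≡ columnPath (suc m) (suc (suc r)) hs
spread-columnPath-> m []       k<r = refl
spread-columnPath-> m (h ∷ hs) k<r
  rewrite spreadPt-> m h k<r = cong (_ ∷_) (spread-columnPath-> m hs (m<n⇒m<1+n k<r))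

spread-columnPath : ∀ m r d hs → d < length hs → spread (col m (r + d)) (columnPath m r hs) ≡ columnPath (suc m) r (insertPeak d hs)
spread-columnPath m r zero (h ∷ hs) _ rewrite +-identityʳ r | spreadPt-≡ m r h =
  cong (λ ps → _ ∷ _ ∷ _ ∷ ps) (spread-columnPath-> m hs (n<1+n r))
spread-columnPath m r (suc d) (h ∷ hs) (s≤s d<hs) rewrite spreadPt-< m h (m<m+n r {suc d} z<s) =
  cong (_ ∷_) (subst (λ k → spread (col m k) (columnPath m (suc r) hs) ≡ columnPath (suc m) (suc r) (insertPeak d hs))
                     (sym (+-suc r d)) (spread-columnPath m (suc r) d hs d<hs))

height-insertPeak-≤ : ∀ k hs r → r ≤ k → height (insertPeak k hs) r ≡ height hs r
height-insertPeak-≤ zero    []       r       _         = refl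
height-insertPeak-≤ (suc k) []       r       _         = refl
height-insertPeak-≤ zero    (h ∷ hs) zero    _         = refl
height-insertPeak-≤ (suc k) (h ∷ hs) zero    _         = refl
height-insertPeak-≤ (suc k) (h ∷ hs) (suc r) (s≤s r≤k) = height-insertPeak-≤ k hs r r≤k

height-insertPeak-peak : ∀ k hs → k < length hs → height (insertPeak k hs) (suc k) ≡ height hs k ℤ.+ 1ℤ
height-insertPeak-peak zero    (h ∷ hs) _         = refl
height-insertPeak-peak (suc k) (h ∷ hs) (s≤s k<n) = height-insertPeak-peak k hs k<n

height-insertPeak-> : ∀ k hs r → k < length hs → k ≤ r → height (insertPeak k hs) (suc (suc r)) ≡ height hs r
height-insertPeak-> zero    (h ∷ hs) zero    _         _         = refl
height-insertPeak-> zero    (h ∷ hs) (suc r) _         _         = refl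
height-insertPeak-> (suc k) (h ∷ hs) (suc r) (s≤s k<n) (s≤s k≤r) = height-insertPeak-> k hs r k<n k≤r

length-insertPeak : ∀ k hs → k < length hs → length (insertPeak k hs) ≡ suc (suc (length hs))
length-insertPeak zero    (h ∷ hs) _         = refl
length-insertPeak (suc k) (h ∷ hs) (s≤s k<n) = cong suc (length-insertPeak k hs k<n)

anyᵇ-map : ∀ {A B : Set} (f : B → Bool) (g : A → B) xs → anyᵇ f (map g xs) ≡ anyᵇ (λ x → f (g x)) xs
anyᵇ-map f g []       = refl
anyᵇ-map f g (x ∷ xs) rewrite anyᵇ-map f g xs = refl

anyᵇ-cong : ∀ {A : Set} {f g : A → Bool} → (∀ x → f x ≡ g x) → ∀ xs → anyᵇ f xs ≡ anyᵇ g xs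
anyᵇ-cong f≡g []       = refl
anyᵇ-cong f≡g (x ∷ xs) rewrite f≡g x | anyᵇ-cong f≡g xs = refl

anyᵇ-none : ∀ {A : Set} {f : A → Bool} → (∀ x → f x ≡ false) → ∀ xs → anyᵇ f xs ≡ false
anyᵇ-none none []       = refl
anyᵇ-none none (x ∷ xs) rewrite none x = anyᵇ-none none xs

anyᵇ-++ : ∀ {A : Set} (f : A → Bool) xs ys → anyᵇ f (xs ++ ys) ≡ (if anyᵇ f xs then true else anyᵇ f ys)
anyᵇ-++ f []       ys = refl
anyᵇ-++ f (x ∷ xs) ys with f x
... | true  = refl
... | false = anyᵇ-++ f xs ys

oneBoxTop : List Path → ℤ → ℤ → Bool
oneBoxTop ts c y = anyᵇ (isOneBoxTopAt (c , y)) ts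

spreadPt-nonempty : ∀ s p → ∃₂ λ q qs → spreadPt s p ≡ q ∷ qs
spreadPt-nonempty s (x , y) with x <ᶻ s | x ==ᶻ s
... | true  | _     = _ , _ , refl
... | false | true  = _ , _ , refl
... | false | false = _ , _ , refl

isOneBoxTopAt-spread-long : ∀ pt s p₁ p₂ ps → isOneBoxTopAt pt (spread s (p₁ ∷ p₂ ∷ ps)) ≡ false
isOneBoxTopAt-spread-long pt s p₁ p₂ ps with spreadPt s p₁ | spreadPt-nonempty s p₁ | spreadPt s p₂ | spreadPt-nonempty s p₂
... | _ | _ , []    , refl | _ | _ , _ , refl = refl
... | _ | _ , _ ∷ _ , refl | _ | _ , _ , refl = refl

spread-single : ∀ s p → spread s (p ∷ []) ≡ spreadPt s p
spread-single s p = ++-identityʳ (spreadPt s p)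

<⇒==ᶻfalse : ∀ {x y} → x ℤ.< y → (x ==ᶻ y) ≡ false
<⇒==ᶻfalse x<y = ==ᶻ-false (ℤ.<⇒≢ x<y)

>⇒==ᶻfalse : ∀ {x y} → y ℤ.< x → (x ==ᶻ y) ≡ false
>⇒==ᶻfalse y<x = ==ᶻ-false (λ x≡y → ℤ.<⇒≢ y<x (sym x≡y))

>⇐<ᶻ==ᶻ : ∀ {x y} → (x <ᶻ y) ≡ false → (x ==ᶻ y) ≡ false → y ℤ.< x
>⇐<ᶻ==ᶻ x≮y x≢y = ℤ.≤∧≢⇒< (<ᶻ≡false⇒≥ x≮y) (λ y≡x → false⇒no (==ᶻ-reflects _ _) x≢y (sym y≡x))

i-1<i : ∀ x → x ℤ.- 1ℤ ℤ.< x
i-1<i x = subst (x ℤ.- 1ℤ ℤ.<_) (lemma x) (i<i+1 (x ℤ.- 1ℤ))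
  where
  lemma : ∀ x → (x ℤ.- 1ℤ) ℤ.+ 1ℤ ≡ x
  lemma = solve-∀

-- The three columns created by spreading carry no one-box tile.
isOneBoxTopAt-spread-new : ∀ m {k r} y t → k ≤ r → r ≤ suc (suc k) →
  isOneBoxTopAt (col (suc m) r , y) (spread (col m k) t) ≡ false
isOneBoxTopAt-spread-new m y []             _ _ = refl
isOneBoxTopAt-spread-new m y (p₁ ∷ p₂ ∷ ps) _ _ = isOneBoxTopAt-spread-long _ _ p₁ p₂ ps
isOneBoxTopAt-spread-new m {k} {r} y ((a , b) ∷ []) k≤r r≤k+2 rewrite spread-single (col m k) (a , b)
  with a <ᶻ col m k in a<s | a ==ᶻ col m k in a≡s
... | true  | _ rewrite <⇒==ᶻfalse {a ℤ.- 1ℤ} {col (suc m) r}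
                        (ℤ.<-≤-trans (subst (a ℤ.- 1ℤ ℤ.<_) (col-1 m k) (ℤ.+-monoˡ-< (ℤ.- 1ℤ) (<ᶻ≡true⇒< {a} {col m k} a<s)))
                                     (col-mono-≤ (suc m) k≤r)) = refl
... | false | true  = refl
... | false | false rewrite >⇒==ᶻfalse {a ℤ.+ 1ℤ} {col (suc m) r}
                        (ℤ.≤-<-trans (col-mono-≤ (suc m) r≤k+2)
                                     (subst (ℤ._< a ℤ.+ 1ℤ) (col+1≡col-suc m k) (ℤ.+-monoˡ-< 1ℤ (>⇐<ᶻ==ᶻ {a} {col m k} a<s a≡s)))) = refl

isOneBoxTopAt-spread-> : ∀ m {k r} y t → k < r →
  isOneBoxTopAt (col (suc m) (suc (suc r)) , y) (spread (col m k) t) ≡ isOneBoxTopAt (col m r , y) t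
isOneBoxTopAt-spread-> m y []             k<r = refl
isOneBoxTopAt-spread-> m y (p₁ ∷ p₂ ∷ ps) k<r = isOneBoxTopAt-spread-long _ _ p₁ p₂ ps
isOneBoxTopAt-spread-> m {k} {r} y ((a , b) ∷ []) k<r rewrite spread-single (col m k) (a , b)
  with a <ᶻ col m k in a<s | a ==ᶻ col m k in a≡s
... | true | _ rewrite <⇒==ᶻfalse {a} (ℤ.<-trans (<ᶻ≡true⇒< {a} {col m k} a<s) (col-mono-< m k<r))
                     | sym (col+1≡col-suc m r)
                     | <⇒==ᶻfalse (ℤ.<-trans (i-1<i a) (ℤ.<-trans (<ᶻ≡true⇒< {a} {col m k} a<s) (ℤ.<-trans (col-mono-< m k<r) (i<i+1 (col m r))))) = refl
... | false | true  = sym (cong (_∧ _) (trans (cong (_==ᶻ col m r) (==ᶻ≡true⇒≡ a≡s)) (<⇒==ᶻfalse (col-mono-< m k<r))))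
... | false | false rewrite sym (col+1≡col-suc m r) | +-==ᶻ a (col m r) 1ℤ = refl

oneBoxTop-spread-new : ∀ m {k r} y ts → k ≤ r → r ≤ suc (suc k) → oneBoxTop (map (spread (col m k)) ts) (col (suc m) r) y ≡ false
oneBoxTop-spread-new m y ts k≤r r≤k+2 = trans (anyᵇ-map _ _ ts) (anyᵇ-none (λ t → isOneBoxTopAt-spread-new m y t k≤r r≤k+2) ts)

oneBoxTop-spread-> : ∀ m {k r} y ts → k < r → oneBoxTop (map (spread (col m k)) ts) (col (suc m) (suc (suc r))) y ≡ oneBoxTop ts (col m r) y
oneBoxTop-spread-> m y ts k<r = trans (anyᵇ-map _ _ ts) (anyᵇ-cong (λ t → isOneBoxTopAt-spread-> m y t k<r) ts)

InRange : ℤ → Maybe ℤ → Point → Bool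
InRange s Q pt = strictlyBetween s Q (proj₁ pt)

raisePoint : ℤ → Maybe ℤ → Point → Point
raisePoint s Q pt = if InRange s Q pt then (proj₁ pt , proj₂ pt ℤ.+ ℤ.+ 2) else pt

newTiles : ℤ → Maybe ℤ → Path → List Path
newTiles s Q P = map (λ pt → pt ∷ []) (filterᵇ (InRange s Q) P)

raiseHeights : ℕ → ℕ → ℕ → List ℤ → List ℤ
raiseHeights a b r []       = []
raiseHeights a b r (h ∷ hs) = (if (a <ᵇ r) ∧ (r <ᵇ b) then h ℤ.+ ℤ.+ 2 else h) ∷ raiseHeights a b (suc r) hs

InRange-col : ∀ M a b r h → InRange (col M a) (just (col M b)) (col M r , h) ≡ (a <ᵇ r) ∧ (r <ᵇ b)
InRange-col M a b r h = cong₂ _∧_ (col-<ᶻ M a r) (col-<ᶻ M r b)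

map-raisePoint : ∀ M a b r hs →
  map (raisePoint (col M a) (just (col M b))) (columnPath M r hs) ≡ columnPath M r (raiseHeights a b r hs)
map-raisePoint M a b r []       = refl
map-raisePoint M a b r (h ∷ hs) rewrite map-raisePoint M a b (suc r) hs | InRange-col M a b r h
  with (a <ᵇ r) ∧ (r <ᵇ b)
... | true  = refl
... | false = refl

height-raiseHeights : ∀ a b r hs i → i < length hs →
  height (raiseHeights a b r hs) i ≡ (if (a <ᵇ r + i) ∧ (r + i <ᵇ b) then height hs i ℤ.+ ℤ.+ 2 else height hs i)
height-raiseHeights a b r (h ∷ hs) zero    _         rewrite +-identityʳ r = refl
height-raiseHeights a b r (h ∷ hs) (suc i) (s≤s i<n) rewrite +-suc r i = height-raiseHeights a b (suc r) hs i i<n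

length-raiseHeights : ∀ a b r hs → length (raiseHeights a b r hs) ≡ length hs
length-raiseHeights a b r []       = refl
length-raiseHeights a b r (h ∷ hs) = cong suc (length-raiseHeights a b (suc r) hs)

filterᵇ-∷ : ∀ {A : Set} (p : A → Bool) x xs → filterᵇ p (x ∷ xs) ≡ (if p x then x ∷ filterᵇ p xs else filterᵇ p xs)
filterᵇ-∷ p x xs with p x
... | true  = refl
... | false = refl

∧-true₁ : ∀ {x y} → (x ∧ y) ≡ true → x ≡ true
∧-true₁ {true} _ = refl

oneBoxTop-newTiles-∷ : ∀ s Q pt P {c y} → oneBoxTop (newTiles s Q P) c y ≡ true → oneBoxTop (newTiles s Q (pt ∷ P)) c y ≡ true
oneBoxTop-newTiles-∷ s Q pt P {c} {y} found rewrite filterᵇ-∷ (InRange s Q) pt P with InRange s Q pt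
... | false = found
... | true with isOneBoxTopAt (c , y) (pt ∷ [])
...   | true  = refl
...   | false = found

oneBoxTop-newTiles-≤ : ∀ M a b r₀ hs {r} y → r ≤ a →
  oneBoxTop (newTiles (col M a) (just (col M b)) (columnPath M r₀ hs)) (col M r) y ≡ false
oneBoxTop-newTiles-≤ M a b r₀ []       y r≤a = refl
oneBoxTop-newTiles-≤ M a b r₀ (h ∷ hs) {r} y r≤a
  rewrite filterᵇ-∷ (InRange (col M a) (just (col M b))) (col M r₀ , h) (columnPath M (suc r₀) hs) | InRange-col M a b r₀ h
  with (a <ᵇ r₀) ∧ (r₀ <ᵇ b) in inRange
... | false = oneBoxTop-newTiles-≤ M a b (suc r₀) hs y r≤a
... | true rewrite col-==ᶻ M r₀ r | ≡ᵇ-false {r₀} {r} (λ r₀≡r → <⇒≱ (<ᵇ≡true⇒< (∧-true₁ inRange)) (subst (_≤ a) (sym r₀≡r) r≤a)) =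
  oneBoxTop-newTiles-≤ M a b (suc r₀) hs y r≤a

oneBoxTop-newTiles-between : ∀ M a b r₀ hs d → a < r₀ + d → r₀ + d < b → d < length hs →
  oneBoxTop (newTiles (col M a) (just (col M b)) (columnPath M r₀ hs)) (col M (r₀ + d)) (height hs d ℤ.+ ℤ.+ 2) ≡ true
oneBoxTop-newTiles-between M a b r₀ (h ∷ hs) zero a< <b _
  rewrite +-identityʳ r₀
        | filterᵇ-∷ (InRange (col M a) (just (col M b))) (col M r₀ , h) (columnPath M (suc r₀) hs) | InRange-col M a b r₀ h
        | <ᵇ-true a< | <ᵇ-true <b | col-==ᶻ M r₀ r₀ | ≡ᵇ-refl r₀ | ==ᶻ-refl (h ℤ.+ ℤ.+ 2) = refl
oneBoxTop-newTiles-between M a b r₀ (h ∷ hs) (suc d) a< <b (s≤s d<n) =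
  oneBoxTop-newTiles-∷ (col M a) (just (col M b)) (col M r₀ , h) (columnPath M (suc r₀) hs)
    (subst (λ k → oneBoxTop (newTiles (col M a) (just (col M b)) (columnPath M (suc r₀) hs)) (col M k) (height hs d ℤ.+ ℤ.+ 2) ≡ true)
           (sym (+-suc r₀ d))
           (oneBoxTop-newTiles-between M a b (suc r₀) hs d (subst (a <_) (+-suc r₀ d) a<) (subst (_< b) (+-suc r₀ d) <b) d<n))

eligibleStep : ℕ → List Path → ℕ → ℤ → ℤ → Bool
eligibleStep m ts c h h′ = ((h ℤ.+ 1ℤ) ==ᶻ h′) ∧ not (oneBoxTop ts (col m c) h′)

eligibleIndices : ℕ → List Path → ℕ → List ℤ → List ℕ
eligibleIndices m ts r (h ∷ h′ ∷ hs) =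
  (if eligibleStep m ts (suc r) h h′ then suc r ∷ [] else []) ++ eligibleIndices m ts (suc r) (h′ ∷ hs)
eligibleIndices m ts r _ = []

eligibleColumns-columnPath : ∀ m ts r hs →
  map proj₁ (filterᵇ (λ pt → not (anyᵇ (isOneBoxTopAt pt) ts)) (upStepEnds (columnPath m r hs)))
    ≡ map (col m) (eligibleIndices m ts r hs)
eligibleColumns-columnPath m ts r []       = refl
eligibleColumns-columnPath m ts r (h ∷ []) = refl
eligibleColumns-columnPath m ts r (h ∷ h′ ∷ hs) = begin
    map proj₁ (filterᵇ eligible (firstEnd ++ upStepEnds (columnPath m (suc r) (h′ ∷ hs))))
  ≡⟨ cong (map proj₁) (filter-++ _ firstEnd _) ⟩
    map proj₁ (filterᵇ eligible firstEnd ++ filterᵇ eligible (upStepEnds (columnPath m (suc r) (h′ ∷ hs))))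
  ≡⟨ map-++ proj₁ (filterᵇ eligible firstEnd) _ ⟩
    map proj₁ (filterᵇ eligible firstEnd) ++ map proj₁ (filterᵇ eligible (upStepEnds (columnPath m (suc r) (h′ ∷ hs))))
  ≡⟨ cong₂ _++_ first (eligibleColumns-columnPath m ts (suc r) (h′ ∷ hs)) ⟩
    map (col m) firstIndex ++ map (col m) (eligibleIndices m ts (suc r) (h′ ∷ hs))
  ≡⟨ map-++ (col m) firstIndex _ ⟨
    map (col m) (eligibleIndices m ts r (h ∷ h′ ∷ hs))
  ∎
  where
  open ≡-Reasoning
  eligible : Point → Bool
  eligible pt = not (anyᵇ (isOneBoxTopAt pt) ts)
  firstEnd   = if (h ℤ.+ 1ℤ) ==ᶻ h′ then (col m (suc r) , h′) ∷ [] else []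
  firstIndex = if eligibleStep m ts (suc r) h h′ then suc r ∷ [] else []
  first : map proj₁ (filterᵇ eligible firstEnd) ≡ map (col m) firstIndex
  first with (h ℤ.+ 1ℤ) ==ᶻ h′
  ... | false = refl
  ... | true with oneBoxTop ts (col m (suc r)) h′
  ...   | true  = refl
  ...   | false = refl

eligibleAt : ℕ → List Path → ℕ → List ℤ → ℕ → Bool
eligibleAt m ts r hs i = eligibleStep m ts (suc (r + i)) (height hs i) (height hs (suc i))

eligibleAt-suc : ∀ m ts r h hs i → eligibleAt m ts r (h ∷ hs) (suc i) ≡ eligibleAt m ts (suc r) hs i
eligibleAt-suc m ts r h hs i rewrite +-suc r i = refl

eligibleAt-zero : ∀ m ts r h h′ hs → eligibleAt m ts r (h ∷ h′ ∷ hs) 0 ≡ eligibleStep m ts (suc r) h h′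
eligibleAt-zero m ts r h h′ hs rewrite +-identityʳ r = refl

if-false : ∀ {A : Set} {b} {x y : A} → b ≡ false → (if b then x else y) ≡ y
if-false refl = refl

if-true : ∀ {A : Set} {b} {x y : A} → b ≡ true → (if b then x else y) ≡ x
if-true refl = refl

eligibleIndices-none : ∀ m ts r hs → (∀ i → suc i < length hs → eligibleAt m ts r hs i ≡ false) → eligibleIndices m ts r hs ≡ []
eligibleIndices-none m ts r []            none = refl
eligibleIndices-none m ts r (h ∷ [])      none = refl
eligibleIndices-none m ts r (h ∷ h′ ∷ hs) none = cong₂ _++_
  (if-false (trans (sym (eligibleAt-zero m ts r h h′ hs)) (none 0 (s≤s (s≤s z≤n)))))
  (eligibleIndices-none m ts (suc r) (h′ ∷ hs) (λ i i<n → trans (sym (eligibleAt-suc m ts r h (h′ ∷ hs) i)) (none (suc i) (s≤s i<n))))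

last-++ʳ : ∀ {A : Set} (xs ys : List A) {x} → List.last ys ≡ just x → List.last (xs ++ ys) ≡ just x
last-++ʳ []           ys      eq = eq
last-++ʳ (z ∷ [])     (y ∷ _) eq = eq
last-++ʳ (z ∷ w ∷ zs) ys      eq = last-++ʳ (w ∷ zs) ys eq

last-eligibleIndices : ∀ m ts r hs j → suc j < length hs → eligibleAt m ts r hs j ≡ true →
  (∀ i → j < i → suc i < length hs → eligibleAt m ts r hs i ≡ false) →
  List.last (eligibleIndices m ts r hs) ≡ just (suc (r + j))
last-eligibleIndices m ts r (h ∷ []) zero (s≤s ()) _ _
last-eligibleIndices m ts r (h ∷ h′ ∷ hs) zero _ eligible none =
  trans (cong (λ is → List.last (is ++ eligibleIndices m ts (suc r) (h′ ∷ hs)))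
              (if-true {x = suc r ∷ []} {y = []} (trans (sym (eligibleAt-zero m ts r h h′ hs)) eligible)))
  (trans (cong (λ is → List.last (suc r ∷ is))
               (eligibleIndices-none m ts (suc r) (h′ ∷ hs)
                 (λ i i<n → trans (sym (eligibleAt-suc m ts r h (h′ ∷ hs) i)) (none (suc i) z<s (s≤s i<n)))))
         (cong (λ k → just (suc k)) (sym (+-identityʳ r))))
last-eligibleIndices m ts r (h ∷ h′ ∷ hs) (suc j) (s≤s j<n) eligible none =
  last-++ʳ (if eligibleStep m ts (suc r) h h′ then suc r ∷ [] else []) _
    (trans (last-eligibleIndices m ts (suc r) (h′ ∷ hs) j j<n (trans (sym (eligibleAt-suc m ts r h (h′ ∷ hs) j)) eligible)
             (λ i j<i i<n → trans (sym (eligibleAt-suc m ts r h (h′ ∷ hs) i)) (none (suc i) (s≤s j<i) (s≤s i<n))))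
           (cong (λ k → just (suc k)) (sym (+-suc r j))))

heightSteps : List ℤ → List Bool
heightSteps (h ∷ h′ ∷ hs) = (h <ᶻ h′) ∷ heightSteps (h′ ∷ hs)
heightSteps _             = []

stepsUp-columnPath : ∀ m r hs → stepsUp (columnPath m r hs) ≡ heightSteps hs
stepsUp-columnPath m r []            = refl
stepsUp-columnPath m r (h ∷ [])      = refl
stepsUp-columnPath m r (h ∷ h′ ∷ hs) = cong ((h <ᶻ h′) ∷_) (stepsUp-columnPath m (suc r) (h′ ∷ hs))

discordant : List ℤ → List ℤ → ℕ → Bool
discordant ls us i = not (height ls i <ᶻ height ls (suc i)) ∧ (height us i <ᶻ height us (suc i))

zip-heightSteps : ∀ n ls us → length ls ≡ suc n → length us ≡ suc n →
  map (λ ab → not (proj₁ ab) ∧ proj₂ ab) (zip (heightSteps ls) (heightSteps us)) ≡ applyUpTo (discordant ls us) n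
zip-heightSteps zero    (a ∷ [])      (b ∷ [])      _  _  = refl
zip-heightSteps (suc n) (a ∷ a′ ∷ ls) (b ∷ b′ ∷ us) eℓ eᵤ =
  cong (_ ∷_) (zip-heightSteps n (a′ ∷ ls) (b′ ∷ us) (suc-injective eℓ) (suc-injective eᵤ))

dis-columnPath : ∀ m n ls us ts → length ls ≡ suc n → length us ≡ suc n →
  dis (tiling (columnPath m 0 ls) (columnPath m 0 us) ts) ≡ countᵇ (applyUpTo (discordant ls us) n)
dis-columnPath m n ls us ts eℓ eᵤ rewrite stepsUp-columnPath m 0 ls | stepsUp-columnPath m 0 us =
  cong countᵇ (zip-heightSteps n ls us eℓ eᵤ)

countᵇ-∷ : ∀ b {xs ys} → countᵇ xs ≡ countᵇ ys → countᵇ (b ∷ xs) ≡ countᵇ (b ∷ ys)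
countᵇ-∷ true  eq = cong suc eq
countᵇ-∷ false eq = eq

countᵇ-∷-suc : ∀ b {xs ys} → countᵇ xs ≡ suc (countᵇ ys) → countᵇ (b ∷ xs) ≡ suc (countᵇ (b ∷ ys))
countᵇ-∷-suc true  eq = cong suc eq
countᵇ-∷-suc false eq = eq

applyUpTo-cong : ∀ {A : Set} {f g : ℕ → A} → (∀ x → f x ≡ g x) → ∀ n → applyUpTo f n ≡ applyUpTo g n
applyUpTo-cong f≡g n = applyUpTo-cong< n (λ x _ → f≡g x)

countᵇ-insert-false₂ : ∀ p n (f g : ℕ → Bool) → p ≤ n → (∀ i → i < p → g i ≡ f i) → g p ≡ false → g (suc p) ≡ false →
  (∀ i → p ≤ i → g (suc (suc i)) ≡ f i) → countᵇ (applyUpTo g (suc (suc n))) ≡ countᵇ (applyUpTo f n)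
countᵇ-insert-false₂ zero n f g _ _ gp gp+1 after rewrite gp | gp+1 = cong countᵇ (applyUpTo-cong (λ i → after i z≤n) n)
countᵇ-insert-false₂ (suc p) (suc n) f g (s≤s p≤n) before gp gp+1 after rewrite before 0 z<s =
  countᵇ-∷ (f 0) (countᵇ-insert-false₂ p n (λ i → f (suc i)) (λ i → g (suc i)) p≤n
                   (λ i i<p → before (suc i) (s<s i<p)) gp gp+1 (λ i p≤i → after (suc i) (s≤s p≤i)))

countᵇ-flip : ∀ c n (f g : ℕ → Bool) → c < n → (∀ i → i ≢ c → i < n → g i ≡ f i) → f c ≡ false → g c ≡ true →
  countᵇ (applyUpTo g n) ≡ suc (countᵇ (applyUpTo f n))
countᵇ-flip zero (suc n) f g _ same fc gc rewrite fc | gc =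
  cong (λ xs → suc (countᵇ xs)) (applyUpTo-cong< n (λ i i<n → same (suc i) (λ ()) (s<s i<n)))
countᵇ-flip (suc c) (suc n) f g (s≤s c<n) same fc gc rewrite same 0 (λ ()) z<s =
  countᵇ-∷-suc (f 0) (countᵇ-flip c n (λ i → f (suc i)) (λ i → g (suc i)) c<n
                       (λ i i≢c i<n → same (suc i) (λ eq → i≢c (suc-injective eq)) (s<s i<n)) fc gc)

-- Growing a Dyck tiling by one chord

eligibleStep-true : ∀ m ts c h h′ → ((h ℤ.+ 1ℤ) ==ᶻ h′) ≡ true → oneBoxTop ts (col m c) h′ ≡ false → eligibleStep m ts c h h′ ≡ true
eligibleStep-true m ts c h h′ rises free rewrite rises | free = refl

eligibleStep-down : ∀ m ts c h h′ → ((h ℤ.+ 1ℤ) ==ᶻ h′) ≡ false → eligibleStep m ts c h h′ ≡ false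
eligibleStep-down m ts c h h′ notUp rewrite notUp = refl

eligibleStep-covered : ∀ m ts c h h′ → (((h ℤ.+ 1ℤ) ==ᶻ h′) ≡ true → oneBoxTop ts (col m c) h′ ≡ true) → eligibleStep m ts c h h′ ≡ false
eligibleStep-covered m ts c h h′ covered with (h ℤ.+ 1ℤ) ==ᶻ h′ in rises
... | false = refl
... | true rewrite covered refl = refl

eligibleStep-false : ∀ m ts c h h′ → eligibleStep m ts c h h′ ≡ false → ((h ℤ.+ 1ℤ) ==ᶻ h′) ≡ true → oneBoxTop ts (col m c) h′ ≡ true
eligibleStep-false m ts c h h′ notEligible rises with oneBoxTop ts (col m c) h′
... | true  = refl
... | false rewrite rises = sym notEligible

-- Both paths of T rise into column j + 1 of order m, and that column is the special one:
-- it is eligible while every later up step of the upper path ends on top of a one-box tile.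
record GrownTiling (m : ℕ) (T : Tiling) (j : ℕ) : Set where
  field
    ls us        : List ℤ
    lower≡       : lower T ≡ columnPath m 0 ls
    upper≡       : upper T ≡ columnPath m 0 us
    length-ls    : length ls ≡ suc (2 * m)
    length-us    : length us ≡ suc (2 * m)
    j<2m         : j < 2 * m
    lowerUp      : height ls (suc j) ≡ height ls j ℤ.+ 1ℤ
    upperUp      : height us (suc j) ≡ height us j ℤ.+ 1ℤ
    peakFree     : oneBoxTop (tiles T) (col m (suc j)) (height us (suc j)) ≡ false
    laterCovered : ∀ r → j < r → suc r < suc (2 * m) → ((height us r ℤ.+ 1ℤ) ==ᶻ height us (suc r)) ≡ true →
                   oneBoxTop (tiles T) (col m (suc r)) (height us (suc r)) ≡ true

2+2*≡2*suc : ∀ m → suc (suc (suc (2 * m))) ≡ suc (2 * suc m)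
2+2*≡2*suc m = cong suc (sym (2*suc m))

i+1+1≡i+2 : ∀ u → (u ℤ.+ 1ℤ) ℤ.+ 1ℤ ≡ u ℤ.+ ℤ.+ 2
i+1+1≡i+2 = solve-∀

module Grow {m T j} (grown : GrownTiling m T j) {p} (p≤2m : p ≤ 2 * m) where
  open GrownTiling grown

  M : ℕ
  M = suc m

  n″ : ℕ
  n″ = suc (suc (suc (2 * m)))

  ts ts″ : List Path
  ts  = tiles T
  ts″ = map (spread (col m p)) ts

  ls″ us″ : List ℤ
  ls″ = insertPeak p ls
  us″ = insertPeak p us

  p<ls : p < length ls
  p<ls rewrite length-ls = s≤s p≤2m

  p<us : p < length us
  p<us rewrite length-us = s≤s p≤2m

  length-ls″ : length ls″ ≡ n″
  length-ls″ = trans (length-insertPeak p ls p<ls) (cong (λ n → suc (suc n)) length-ls)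

  length-us″ : length us″ ≡ n″
  length-us″ = trans (length-insertPeak p us p<us) (cong (λ n → suc (suc n)) length-us)

  -- When p ≤ j the old special column j + 1 moves to j + 3 and stays special.
  oldPeak-eligible : p ≤ j → eligibleAt M ts″ 0 us″ (suc (suc j)) ≡ true
  oldPeak-eligible p≤j
    rewrite height-insertPeak-> p us j p<us p≤j | height-insertPeak-> p us (suc j) p<us (m≤n⇒m≤1+n p≤j)
    = eligibleStep-true M ts″ (suc (suc (suc j))) (height us j) (height us (suc j))
        (trans (cong ((height us j ℤ.+ 1ℤ) ==ᶻ_) upperUp) (==ᶻ-refl (height us j ℤ.+ 1ℤ)))
        (trans (oneBoxTop-spread-> m (height us (suc j)) ts (s≤s p≤j)) peakFree)

  oldPeak-last : p ≤ j → ∀ i → suc (suc j) < i → suc i < n″ → eligibleAt M ts″ 0 us″ i ≡ false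
  oldPeak-last p≤j (suc (suc i)) (s≤s (s≤s j<i)) (s≤s (s≤s i<)) =
    subst₂ (λ h h′ → eligibleStep M ts″ (suc (suc (suc i))) h h′ ≡ false)
      (sym (height-insertPeak-> p us i p<us p≤i)) (sym (height-insertPeak-> p us (suc i) p<us (m≤n⇒m≤1+n p≤i)))
      (eligibleStep-covered M ts″ (suc (suc (suc i))) (height us i) (height us (suc i))
        (λ rises → trans (oneBoxTop-spread-> m (height us (suc i)) ts (s≤s p≤i)) (laterCovered i j<i i< rises)))
    where
    p≤i : p ≤ i
    p≤i = ≤-trans p≤j (<⇒≤ j<i)

  -- When j < p the new peak at column p + 1 becomes special.
  newPeak-eligible : eligibleAt M ts″ 0 us″ p ≡ true
  newPeak-eligible rewrite height-insertPeak-≤ p us p ≤-refl | height-insertPeak-peak p us p<us =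
    eligibleStep-true M ts″ (suc p) (height us p) (height us p ℤ.+ 1ℤ) (==ᶻ-refl (height us p ℤ.+ 1ℤ))
      (oneBoxTop-spread-new m _ ts (n≤1+n p) (n≤1+n (suc p)))

  newPeak-last : j < p → ∀ i → p < i → suc i < n″ → eligibleAt M ts″ 0 us″ i ≡ false
  newPeak-last j<p (suc i) (s≤s p≤i) i< with m≤n⇒m<n∨m≡n p≤i
  ... | inj₂ refl rewrite height-insertPeak-peak p us p<us | height-insertPeak-> p us p p<us ≤-refl =
    eligibleStep-down M ts″ (suc (suc p)) (height us p ℤ.+ 1ℤ) (height us p)
      (>⇒==ᶻfalse (ℤ.<-trans (i<i+1 (height us p)) (i<i+1 (height us p ℤ.+ 1ℤ))))
  newPeak-last j<p (suc (suc i)) (s≤s p≤i) (s≤s (s≤s i<)) | inj₁ (s≤s p≤i′) =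
    subst₂ (λ h h′ → eligibleStep M ts″ (suc (suc (suc i))) h h′ ≡ false)
      (sym (height-insertPeak-> p us i p<us p≤i′)) (sym (height-insertPeak-> p us (suc i) p<us (m≤n⇒m≤1+n p≤i′)))
      (eligibleStep-covered M ts″ (suc (suc (suc i))) (height us i) (height us (suc i))
        (λ rises → trans (oneBoxTop-spread-> m (height us (suc i)) ts (s≤s p≤i′)) (laterCovered i (<-≤-trans j<p p≤i′) i< rises)))

  lower-spread : spread (col m p) (lower T) ≡ columnPath M 0 ls″
  lower-spread rewrite lower≡ = spread-columnPath m 0 p ls p<ls

  upper-spread : spread (col m p) (upper T) ≡ columnPath M 0 us″
  upper-spread rewrite upper≡ = spread-columnPath m 0 p us p<us

  specialColumn-spread : ∀ q′ → suc q′ < n″ → eligibleAt M ts″ 0 us″ q′ ≡ true →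
    (∀ i → q′ < i → suc i < n″ → eligibleAt M ts″ 0 us″ i ≡ false) →
    specialColumn (spreadTiling (col m p) T) ≡ just (col M (suc q′))
  specialColumn-spread q′ q′< eligible later = begin
      List.last (map proj₁ (filterᵇ (λ pt → not (anyᵇ (isOneBoxTopAt pt) ts″)) (upStepEnds (spread (col m p) (upper T)))))
    ≡⟨ cong (λ P → List.last (map proj₁ (filterᵇ (λ pt → not (anyᵇ (isOneBoxTopAt pt) ts″)) (upStepEnds P)))) upper-spread ⟩
      List.last (map proj₁ (filterᵇ (λ pt → not (anyᵇ (isOneBoxTopAt pt) ts″)) (upStepEnds (columnPath M 0 us″))))
    ≡⟨ cong List.last (eligibleColumns-columnPath M ts″ 0 us″) ⟩
      List.last (map (col M) (eligibleIndices M ts″ 0 us″))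
    ≡⟨ last-map (col M) (eligibleIndices M ts″ 0 us″) ⟩
      Maybe.map (col M) (List.last (eligibleIndices M ts″ 0 us″))
    ≡⟨ cong (Maybe.map (col M)) (last-eligibleIndices M ts″ 0 us″ q′ (subst (suc q′ <_) (sym length-us″) q′<) eligible
                                    (λ i q′<i i< → later i q′<i (subst (suc i <_) length-us″ i<))) ⟩
      just (col M (suc q′))
    ∎
    where open ≡-Reasoning

  rgrow-shape : ∀ q → specialColumn (spreadTiling (col m p) T) ≡ just (col M q) →
    rgrow T (col m p) ≡ tiling (columnPath M 0 ls″) (columnPath M 0 (raiseHeights (suc p) q 0 us″))
                              (ts″ ++ newTiles (col M (suc p)) (just (col M q)) (columnPath M 0 us″))
  rgrow-shape q special = begin
      rgrow T (col m p)
    ≡⟨ cong (λ Q → tiling (spread (col m p) (lower T)) (map (raisePoint (col m p) Q) (spread (col m p) (upper T)))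
                          (ts″ ++ newTiles (col m p) Q (spread (col m p) (upper T)))) special ⟩
      tiling (spread (col m p) (lower T)) (map (raisePoint (col m p) Q) (spread (col m p) (upper T)))
             (ts″ ++ newTiles (col m p) Q (spread (col m p) (upper T)))
    ≡⟨ cong₂ (λ L U → tiling L (map (raisePoint (col m p) Q) U) (ts″ ++ newTiles (col m p) Q U)) lower-spread upper-spread ⟩
      tiling (columnPath M 0 ls″) (map (raisePoint (col m p) Q) (columnPath M 0 us″))
             (ts″ ++ newTiles (col m p) Q (columnPath M 0 us″))
    ≡⟨ cong (λ s → tiling (columnPath M 0 ls″) (map (raisePoint s Q) (columnPath M 0 us″)) (ts″ ++ newTiles s Q (columnPath M 0 us″)))
            (sym (col-suc-suc m p)) ⟩
      tiling (columnPath M 0 ls″) (map (raisePoint (col M (suc p)) Q) (columnPath M 0 us″))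
             (ts″ ++ newTiles (col M (suc p)) Q (columnPath M 0 us″))
    ≡⟨ cong (λ U → tiling (columnPath M 0 ls″) U (ts″ ++ newTiles (col M (suc p)) Q (columnPath M 0 us″)))
            (map-raisePoint M (suc p) q 0 us″) ⟩
      tiling (columnPath M 0 ls″) (columnPath M 0 (raiseHeights (suc p) q 0 us″))
             (ts″ ++ newTiles (col M (suc p)) Q (columnPath M 0 us″))
    ∎
    where
    open ≡-Reasoning
    Q : Maybe ℤ
    Q = just (col M q)

  -- After spreading, the special column is q′ + 1 and the columns strictly between p + 1 and q′ + 1 are raised.
  module Raised (q′ : ℕ) (q′-shape : q′ ≡ p ⊎ suc p < q′) (q′< : suc q′ < n″)
                (eligible : eligibleAt M ts″ 0 us″ q′ ≡ true)
                (later : ∀ i → q′ < i → suc i < n″ → eligibleAt M ts″ 0 us″ i ≡ false)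
                (lowerRises : suc p < q′ → height ls″ (suc q′) ≡ height ls″ q′ ℤ.+ 1ℤ) where
    q : ℕ
    q = suc q′

    us′ : List ℤ
    us′ = raiseHeights (suc p) q 0 us″

    tiles′ : List Path
    tiles′ = ts″ ++ newTiles (col M (suc p)) (just (col M q)) (columnPath M 0 us″)

    T′ : Tiling
    T′ = tiling (columnPath M 0 ls″) (columnPath M 0 us′) tiles′

    height-us′ : ∀ i → i < n″ → height us′ i ≡ (if (suc p <ᵇ i) ∧ (i <ᵇ q) then height us″ i ℤ.+ ℤ.+ 2 else height us″ i)
    height-us′ i i< = height-raiseHeights (suc p) q 0 us″ i (subst (i <_) (sym length-us″) i<)

    unraised-≤ : ∀ i → i < n″ → i ≤ suc p → height us′ i ≡ height us″ i
    unraised-≤ i i< i≤ rewrite height-us′ i i< | <ᵇ-false {suc p} {i} i≤ = refl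

    unraised-≥ : ∀ i → i < n″ → q ≤ i → height us′ i ≡ height us″ i
    unraised-≥ i i< q≤ rewrite height-us′ i i< | <ᵇ-false {i} {q} q≤ | ∧-zeroʳ (suc p <ᵇ i) = refl

    raised : ∀ i → i < n″ → suc p < i → i < q → height us′ i ≡ height us″ i ℤ.+ ℤ.+ 2
    raised i i< p+1<i i<q rewrite height-us′ i i< | <ᵇ-true p+1<i | <ᵇ-true i<q = refl

    q-rises : height us″ q ≡ height us″ q′ ℤ.+ 1ℤ
    q-rises = sym (==ᶻ≡true⇒≡ (∧-true₁ eligible))

    oneBoxTop-tiles′ : ∀ c y → oneBoxTop tiles′ c y
      ≡ (if oneBoxTop ts″ c y then true else oneBoxTop (newTiles (col M (suc p)) (just (col M q)) (columnPath M 0 us″)) c y)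
    oneBoxTop-tiles′ c y = anyᵇ-++ (isOneBoxTopAt (c , y)) ts″ _

    p<n″ : suc (suc p) < n″
    p<n″ = s≤s (s≤s (s≤s p≤2m))

    laterCovered′ : ∀ r → p < r → suc r < suc (2 * M) → ((height us′ r ℤ.+ 1ℤ) ==ᶻ height us′ (suc r)) ≡ true →
                    oneBoxTop tiles′ (col M (suc r)) (height us′ (suc r)) ≡ true
    laterCovered′ r p<r r<′ rises with subst (suc r <_) (sym (2+2*≡2*suc m)) r<′
    ... | r< with <-cmp (suc r) q
    ...   | tri< r+1<q _ _ rewrite oneBoxTop-tiles′ (col M (suc r)) (height us′ (suc r)) with oneBoxTop ts″ (col M (suc r)) (height us′ (suc r))
    ...     | true  = refl
    ...     | false rewrite raised (suc r) r< (s≤s p<r) r+1<q =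
      oneBoxTop-newTiles-between M (suc p) q 0 us″ (suc r) (s≤s p<r) r+1<q (subst (suc r <_) (sym length-us″) r<)
    laterCovered′ r p<r r<′ rises | r< | tri≈ _ refl _ = ⊥-elim (noRiseIntoSpecial q′-shape)
      where
      noRiseIntoSpecial : q′ ≡ p ⊎ suc p < q′ → ⊥
      noRiseIntoSpecial (inj₁ q′≡p) = <-irrefl (sym q′≡p) p<r
      noRiseIntoSpecial (inj₂ p+1<r) = false⇒no (==ᶻ-reflects (height us′ r ℤ.+ 1ℤ) (height us′ (suc r))) notRising (==ᶻ≡true⇒≡ rises)
        where
        notRising : ((height us′ r ℤ.+ 1ℤ) ==ᶻ height us′ (suc r)) ≡ false
        notRising rewrite raised r (<-trans (n<1+n r) r<) p+1<r (n<1+n r) | unraised-≥ (suc r) r< ≤-refl | q-rises =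
          >⇒==ᶻfalse (ℤ.<-trans (i<i+1 (height us″ r ℤ.+ 1ℤ))
                                (subst (ℤ._< (height us″ r ℤ.+ ℤ.+ 2) ℤ.+ 1ℤ) (sym (i+1+1≡i+2 (height us″ r))) (i<i+1 _)))
    laterCovered′ r p<r r<′ rises | r< | tri> _ _ q<r+1
      rewrite oneBoxTop-tiles′ (col M (suc r)) (height us′ (suc r)) | unraised-≥ (suc r) r< (<⇒≤ q<r+1)
            | eligibleStep-false M ts″ (suc r) (height us″ r) (height us″ (suc r)) (later r (≤-pred q<r+1) r<)
                (trans (cong (λ h → (h ℤ.+ 1ℤ) ==ᶻ height us″ (suc r)) (sym (unraised-≥ r (<-trans (n<1+n r) r<) (≤-pred q<r+1))))
                       rises) = refl

    grown′ : GrownTiling M T′ p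
    grown′ = record
      { ls           = ls″
      ; us           = us′
      ; lower≡       = refl
      ; upper≡       = refl
      ; length-ls    = trans length-ls″ (2+2*≡2*suc m)
      ; length-us    = trans (length-raiseHeights (suc p) q 0 us″) (trans length-us″ (2+2*≡2*suc m))
      ; j<2m         = subst (p <_) (sym (2*suc m)) (s≤s (m≤n⇒m≤1+n p≤2m))
      ; lowerUp      = trans (height-insertPeak-peak p ls p<ls) (cong (ℤ._+ 1ℤ) (sym (height-insertPeak-≤ p ls p ≤-refl)))
      ; upperUp      = trans (unraised-≤ (suc p) (<-trans (n<1+n (suc p)) p<n″) ≤-refl)
                         (trans (height-insertPeak-peak p us p<us)
                                (cong (ℤ._+ 1ℤ) (sym (trans (unraised-≤ p (<-trans (n<1+n p) (<-trans (n<1+n (suc p)) p<n″)) (n≤1+n p))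
                                                            (height-insertPeak-≤ p us p ≤-refl)))))
      ; peakFree     = trans (oneBoxTop-tiles′ _ _) (cong₂ (λ a b → if a then true else b)
                         (oneBoxTop-spread-new m _ ts (n≤1+n p) (n≤1+n (suc p)))
                         (oneBoxTop-newTiles-≤ M (suc p) q 0 us″ _ ≤-refl))
      ; laterCovered = laterCovered′
      }

    discordant-T : dis T ≡ countᵇ (applyUpTo (discordant ls us) (2 * m))
    discordant-T = trans (cong₂ (λ L U → dis (tiling L U ts)) lower≡ upper≡) (dis-columnPath m (2 * m) ls us ts length-ls length-us)

    discordant-T′ : dis T′ ≡ countᵇ (applyUpTo (discordant ls″ us′) (suc (suc (2 * m))))
    discordant-T′ = trans (dis-columnPath M (2 * M) ls″ us′ tiles′ (trans length-ls″ (2+2*≡2*suc m))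
                                        (trans (length-raiseHeights (suc p) q 0 us″) (trans length-us″ (2+2*≡2*suc m))))
                          (cong (λ n → countᵇ (applyUpTo (discordant ls″ us′) n)) (2*suc m))

    -- The steps of the new peak are concordant, so spreading alone does not change dis.
    peakDown-concordant : discordant ls″ us″ (suc p) ≡ false
    peakDown-concordant
      rewrite height-insertPeak-peak p ls p<ls | height-insertPeak-> p ls p p<ls ≤-refl
            | height-insertPeak-peak p us p<us | height-insertPeak-> p us p p<us ≤-refl
            | <ᶻ-false (ℤ.<⇒≤ (i<i+1 (height us p))) = ∧-zeroʳ _

    discordant-spread : countᵇ (applyUpTo (discordant ls″ us″) (suc (suc (2 * m)))) ≡ countᵇ (applyUpTo (discordant ls us) (2 * m))
    discordant-spread = countᵇ-insert-false₂ p (2 * m) (discordant ls us) (discordant ls″ us″) p≤2m before peakUp peakDown-concordant after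
      where
      before : ∀ i → i < p → discordant ls″ us″ i ≡ discordant ls us i
      before i i<p rewrite height-insertPeak-≤ p ls i (<⇒≤ i<p) | height-insertPeak-≤ p ls (suc i) i<p
                         | height-insertPeak-≤ p us i (<⇒≤ i<p) | height-insertPeak-≤ p us (suc i) i<p = refl
      peakUp : discordant ls″ us″ p ≡ false
      peakUp rewrite height-insertPeak-≤ p ls p ≤-refl | height-insertPeak-peak p ls p<ls | <ᶻ-true (i<i+1 (height ls p)) = refl
      after : ∀ i → p ≤ i → discordant ls″ us″ (suc (suc i)) ≡ discordant ls us i
      after i p≤i rewrite height-insertPeak-> p ls i p<ls p≤i | height-insertPeak-> p ls (suc i) p<ls (m≤n⇒m≤1+n p≤i)
                        | height-insertPeak-> p us i p<us p≤i | height-insertPeak-> p us (suc i) p<us (m≤n⇒m≤1+n p≤i) = refl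

    dis-unraised : q′ ≡ p → dis T′ ≡ dis T
    dis-unraised refl = trans discordant-T′ (trans (cong countᵇ (applyUpTo-cong< _ same)) (trans discordant-spread (sym discordant-T)))
      where
      emptyRange : ∀ i → ((suc p <ᵇ i) ∧ (i <ᵇ suc p)) ≡ false
      emptyRange i with suc p <ᵇ i in p+1<ᵇi
      ... | false = refl
      ... | true  = <ᵇ-false {i} {suc p} (<⇒≤ (<ᵇ≡true⇒< {suc p} {i} p+1<ᵇi))
      unchanged : ∀ i → i < n″ → height us′ i ≡ height us″ i
      unchanged i i< rewrite height-us′ i i< | emptyRange i = refl
      same : ∀ i → i < suc (suc (2 * m)) → discordant ls″ us′ i ≡ discordant ls″ us″ i
      same i i< rewrite unchanged i (m<n⇒m<1+n i<) | unchanged (suc i) (s≤s i<) = refl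

    -- Raising the columns after the new peak turns its down step into a discordant one.
    dis-raised : suc p < q′ → dis T′ ≡ suc (dis T)
    dis-raised p+1<q′ = trans discordant-T′
      (trans (countᵇ-flip (suc p) (suc (suc (2 * m))) (discordant ls″ us″) (discordant ls″ us′) (s≤s (s≤s p≤2m)) same peakDown-concordant peakDown-discordant)
             (cong suc (trans discordant-spread (sym discordant-T))))
      where
      peakDown-discordant : discordant ls″ us′ (suc p) ≡ true
      peakDown-discordant
        rewrite unraised-≤ (suc p) (<-trans (n<1+n (suc p)) p<n″) ≤-refl | raised (suc (suc p)) p<n″ ≤-refl (s≤s p+1<q′)
              | height-insertPeak-peak p ls p<ls | height-insertPeak-> p ls p p<ls ≤-refl
              | height-insertPeak-peak p us p<us | height-insertPeak-> p us p p<us ≤-refl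
              | <ᶻ-false (ℤ.<⇒≤ (i<i+1 (height ls p)))
        = <ᶻ-true (subst (height us p ℤ.+ 1ℤ ℤ.<_) (i+1+1≡i+2 (height us p)) (i<i+1 _))
      same : ∀ i → i ≢ suc p → i < suc (suc (2 * m)) → discordant ls″ us′ i ≡ discordant ls″ us″ i
      same i i≢ i< with <-cmp i (suc p)
      ... | tri< i<p+1 _ _ rewrite unraised-≤ i (m<n⇒m<1+n i<) (<⇒≤ i<p+1) | unraised-≤ (suc i) (s≤s i<) i<p+1 = refl
      ... | tri≈ _ i≡ _ = ⊥-elim (i≢ i≡)
      ... | tri> _ _ p+1<i with <-cmp (suc i) q
      ...   | tri< i+1<q _ _ rewrite raised i (m<n⇒m<1+n i<) p+1<i (<-trans (n<1+n i) i+1<q)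
                                   | raised (suc i) (s≤s i<) (<-trans p+1<i (n<1+n i)) i+1<q
                                   | +-<ᶻ (height us″ i) (height us″ (suc i)) (ℤ.+ 2) = refl
      ...   | tri≈ _ refl _ rewrite lowerRises p+1<i | <ᶻ-true (i<i+1 (height ls″ q′)) = refl
      ...   | tri> _ _ q<i+1 rewrite unraised-≥ i (m<n⇒m<1+n i<) (≤-pred q<i+1) | unraised-≥ (suc i) (s≤s i<) (<⇒≤ q<i+1) = refl

  grow-≤ : p ≤ j → GrownTiling M (rgrow T (col m p)) p × dis (rgrow T (col m p)) ≡ suc (dis T)
  grow-≤ p≤j = subst (λ T′ → GrownTiling M T′ p × dis T′ ≡ suc (dis T)) (sym shape) (R.grown′ , R.dis-raised (s≤s (s≤s p≤j)))
    where
    q′< : suc (suc (suc j)) < n″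
    q′< = s≤s (s≤s (s≤s j<2m))
    lowerRises : suc p < suc (suc j) → height ls″ (suc (suc (suc j))) ≡ height ls″ (suc (suc j)) ℤ.+ 1ℤ
    lowerRises _ rewrite height-insertPeak-> p ls (suc j) p<ls (m≤n⇒m≤1+n p≤j) | height-insertPeak-> p ls j p<ls p≤j = lowerUp
    module R = Raised (suc (suc j)) (inj₂ (s≤s (s≤s p≤j))) q′< (oldPeak-eligible p≤j) (oldPeak-last p≤j) lowerRises
    shape : rgrow T (col m p) ≡ R.T′
    shape = rgrow-shape (suc (suc (suc j))) (specialColumn-spread (suc (suc j)) q′< (oldPeak-eligible p≤j) (oldPeak-last p≤j))

  grow-> : j < p → GrownTiling M (rgrow T (col m p)) p × dis (rgrow T (col m p)) ≡ dis T
  grow-> j<p = subst (λ T′ → GrownTiling M T′ p × dis T′ ≡ dis T) (sym shape) (R.grown′ , R.dis-unraised refl)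
    where
    q′< : suc p < n″
    q′< = s≤s (s≤s (m≤n⇒m≤1+n p≤2m))
    module R = Raised p (inj₁ refl) q′< newPeak-eligible (newPeak-last j<p) (λ p+1<p → ⊥-elim (<-asym p+1<p (n<1+n p)))
    shape : rgrow T (col m p) ≡ R.T′
    shape = rgrow-shape (suc p) (specialColumn-spread p q′< newPeak-eligible (newPeak-last j<p))

grow : ∀ {m T j} → GrownTiling m T j → ∀ {p} → p ≤ 2 * m →
  GrownTiling (suc m) (rgrow T (col m p)) p × dis (rgrow T (col m p)) ≡ length (singletonIf (p <ᵇ suc j) m) + dis T
grow {m} {T} {j} grown {p} p≤2m with <-cmp p (suc j)
... | tri< p<j+1 _ _ rewrite <ᵇ-true p<j+1 = Grow.grow-≤ grown p≤2m (≤-pred p<j+1)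
... | tri≈ _ refl _ rewrite <ᵇ-false {p} ≤-refl = Grow.grow-> grown p≤2m ≤-refl
... | tri> _ _ j+1<p rewrite <ᵇ-false (<⇒≤ j+1<p) = Grow.grow-> grown p≤2m (<-trans (n<1+n j) j+1<p)

dis-DTRgo : ∀ ps {m T j} → GrownTiling m T j → GrowthFrom m ps → dis (DTRgo m T ps) ≡ length (growthDES j m ps) + dis T
dis-DTRgo []       _ _ = refl
dis-DTRgo (p ∷ ps) {m} {T} {j} grown (p≤2m , growth) with grow grown p≤2m
... | grown′ , dis≡ = begin
    dis (DTRgo (suc m) (rgrow T (col m p)) ps)
  ≡⟨ dis-DTRgo ps grown′ growth ⟩
    length (growthDES p (suc m) ps) + dis (rgrow T (col m p))
  ≡⟨ cong (length (growthDES p (suc m) ps) +_) dis≡ ⟩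
    length (growthDES p (suc m) ps) + (length (singletonIf (p <ᵇ suc j) m) + dis T)
  ≡⟨ +-assoc (length (growthDES p (suc m) ps)) _ _ ⟨
    length (growthDES p (suc m) ps) + length (singletonIf (p <ᵇ suc j) m) + dis T
  ≡⟨ cong (_+ dis T) (+-comm (length (growthDES p (suc m) ps)) _) ⟩
    length (singletonIf (p <ᵇ suc j) m) + length (growthDES p (suc m) ps) + dis T
  ≡⟨ cong (_+ dis T) (length-++ (singletonIf (p <ᵇ suc j) m)) ⟨
    length (growthDES j m (p ∷ ps)) + dis T
  ∎
  where open ≡-Reasoning

grown-first : GrownTiling 1 (rgrow emptyTiling (col 0 0)) 0
grown-first = record
  { ls = peak ; us = peak ; lower≡ = refl ; upper≡ = refl ; length-ls = refl ; length-us = refl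
  ; j<2m = s≤s z≤n ; lowerUp = refl ; upperUp = refl ; peakFree = refl ; laterCovered = covered }
  where
  peak : List ℤ
  peak = 0ℤ ∷ 1ℤ ∷ 0ℤ ∷ []
  covered : ∀ r → 0 < r → suc r < 3 → ((height peak r ℤ.+ 1ℤ) ==ᶻ height peak (suc r)) ≡ true →
            oneBoxTop [] (col 1 (suc r)) (height peak (suc r)) ≡ true
  covered (suc zero)    _ _                     ()
  covered (suc (suc r)) _ (s≤s (s≤s (s≤s ()))) _

labeled-first : Labeled 1 (up 1 ∷ down 1 ∷ []) 0
labeled-first = record
  { A = [] ; B = down 1 ∷ [] ; length≡ = refl ; fresh = fresh ; split = refl ; lengthA = refl ; i∉A = refl }
  where
  fresh : ∀ c → 1 < c → hasUp c (up 1 ∷ down 1 ∷ []) ≡ false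
  fresh (suc zero)    (s≤s ())
  fresh (suc (suc c)) _ = refl

wellFormed-first : WellFormed 1 ((1 , 2) ∷ [])
wellFormed-first = record
  { length≡ = refl ; ordered = s≤s (s≤s z≤n) ∷ [] ; sorted = [] ∷ [] ; bounded = s≤s (s≤s z≤n) ∷ [] }

DES-sigmaWord : ∀ n W → DES (map (λ j → suc (upsBefore j W)) (applyUpTo suc n)) ≡ DES (upPositions W n)
DES-sigmaWord n W = trans
  (cong DES (trans (map-applyUpTo suc (λ j → suc (upsBefore j W)) n) (sym (map-applyUpTo (λ x → upsBefore (suc x) W) suc n))))
  (DESfrom-map s≤s 1 (upPositions W n))

theorem8 : (n : ℕ) (p : Vec ℕ n) → IsGrowth p →
    (DES (sigma p) ≡ DES (minWord (match p)))
    × (dis (DTR p) ≡ des (minWord (match p)))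
theorem8 zero    []       _      = refl , refl
theorem8 (suc n) (p₁ ∷ v) growth with growth Fin.zero
... | z≤n = trans σ-descents (sym minWord-descents) , trans dis-descents (cong length (sym minWord-descents))
  where
  ps : List ℕ
  ps = toList v
  growth′ : GrowthFrom 1 ps
  growth′ = growthFrom-toList 1 v (λ k → growth (Fin.suc k))
  minWord-descents : DES (minWord (match (0 ∷ v))) ≡ growthDES 0 1 ps
  minWord-descents = DES-minWord-matchGo ps {ws = []} wellFormed-first refl growth′
  σ-descents : DES (sigma (0 ∷ v)) ≡ growthDES 0 1 ps
  σ-descents = trans (DES-sigmaWord (suc n) (labeledGo 1 (up 1 ∷ down 1 ∷ []) ps))
    (subst (λ k → DES (upPositions (labeledGo 1 (up 1 ∷ down 1 ∷ []) ps) (suc k)) ≡ growthDES 0 1 ps) (length-toList v)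
      (DES-upPositions-labeledGo ps labeled-first growth′))
  dis-descents : dis (DTR (0 ∷ v)) ≡ length (growthDES 0 1 ps)
  dis-descents = trans (dis-DTRgo ps grown-first growth′) (+-identityʳ _)
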